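{- Let $\{P_n(x)\}_{n\ge 1}$ and $c_n(k)$ be as defined in the context. For every integer $k\ge 1$ there is a polynomial $R_k$ of degree $k-1$ with integer coefficients such that for every integer $n\ge1$, $$P_n(k)=c_n(k)\left(2^{n+k-1}-\frac{R_k(n)}{(2k-2)!!}\right).$$
   Context: The sequence $\{P_n(x)\}_{n\ge1}$ of rational functions of $x$ is defined by $P_1=P_2=1$ and, for $n\ge 2$: if $n$ is odd, $4(2x+n)P_{n+1}(x)=2(x+n)P_n(x)+(2x+n)P_n(x+1)+(4x+n)\ell_n(x)$; if $n$ is even, $4P_{n+1}(x)=4(x+n)P_n(x)+2(2x+n+1)P_n(x+1)+(4x+n)\ell_{n-1}(x)$. Here for odd $r\ge1$, $\ell_r(x)=\prod_{j=1}^{(r-1)/2}(x+j)$ (the empty product equals $1$). For integers $n,k\ge1$, $c_n(k)=(\frac{n-1}{2})!\prod_{i=1}^{k-1}\frac{n+i}{n+2i}$ if $n$ is odd and $c_n(k)=\frac12(\frac n2-1)!\prod_{i=0}^{k-1}\frac{n+i}{n+2i+1}$ if $n$ is even. Also $(2k-2)!!=2^{k-1}(k-1)!$. -}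

module Defs where

open import Data.Bool using (Bool; true; false; if_then_else_)
open import Data.Nat as ℕ using (ℕ; zero; suc; _∸_; _^_; ⌊_/2⌋)
open import Data.Nat.Properties using (m^n≢0; m*n≢0; _!≢0)
open import Data.Nat.Combinatorics using ()
open import Data.Nat.Base using (_!)
open import Data.Integer as ℤ using (ℤ; +_)
open import Data.Rational using (ℚ; _/_; _+_; _*_; _-_)
open import Data.List using (List; []; _∷_; length; last)
open import Data.Maybe using (just)
open import Data.Product using (_×_)
open import Relation.Binary.PropositionalEquality using (_≡_; _≢_)

ℕtoℚ : ℕ → ℚ
ℕtoℚ a = (+ a) / 1

isOdd : ℕ → Bool
isOdd zero = false
isOdd (suc n) = if isOdd n then false else true

lprod : ℕ → ℕ → ℕ
lprod zero x = 1
lprod (suc t) x = (x ℕ.+ suc t) ℕ.* lprod t x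

-- ℓ_r(x) = ∏_{j=1}^{(r-1)/2} (x+j), for odd r (then (r-1)/2 = ⌊r/2⌋)
ℓ : ℕ → ℕ → ℕ
ℓ r x = lprod ⌊ r /2⌋ x

-- P n k = P_n(k), the rational function P_n evaluated at the natural number k,
-- computed by the defining recursion (all denominators 4(2k+n) are nonzero).
P : ℕ → ℕ → ℚ
P zero k = ℕtoℚ 1   -- junk value, P_0 is not part of the sequence
P (suc zero) k = ℕtoℚ 1
P (suc (suc zero)) k = ℕtoℚ 1
P (suc (suc (suc m))) k =
  if isOdd (suc (suc m))
  then (ℕtoℚ (2 ℕ.* (k ℕ.+ (suc (suc m)))) * P (suc (suc m)) k
         + ℕtoℚ (2 ℕ.* k ℕ.+ (suc (suc m))) * P (suc (suc m)) (suc k)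
         + ℕtoℚ ((4 ℕ.* k ℕ.+ (suc (suc m))) ℕ.* ℓ (suc (suc m)) k))
       * ((+ 1) / (4 ℕ.* (suc (suc m) ℕ.+ 2 ℕ.* k)))
  else (ℕtoℚ (4 ℕ.* (k ℕ.+ (suc (suc m)))) * P (suc (suc m)) k
         + ℕtoℚ (2 ℕ.* (2 ℕ.* k ℕ.+ (suc (suc m)) ℕ.+ 1)) * P (suc (suc m)) (suc k)
         + ℕtoℚ ((4 ℕ.* k ℕ.+ (suc (suc m))) ℕ.* ℓ (suc m) k))
       * ((+ 1) / 4)

oddProd : ℕ → ℕ → ℚ
oddProd n zero = ℕtoℚ 1
oddProd n (suc i) = oddProd n i * ((+ (n ℕ.+ suc i)) / (2 ℕ.* suc i ℕ.+ n))

evenProd : ℕ → ℕ → ℚ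
evenProd n zero = ℕtoℚ 1
evenProd n (suc i) = evenProd n i * ((+ (n ℕ.+ i)) / suc (n ℕ.+ 2 ℕ.* i))

c : ℕ → ℕ → ℚ
c n k =
  if isOdd n
  then ℕtoℚ (⌊ n /2⌋ !) * oddProd n (k ∸ 1)                     -- ((n-1)/2)! ∏_{i=1}^{k-1}
  else ((+ 1) / 2) * ℕtoℚ ((⌊ n /2⌋ ∸ 1) !) * evenProd n k      -- (1/2)(n/2-1)! ∏_{i=0}^{k-1}

-- (2k-2)!! = 2^(k-1) (k-1)!
doubleFact : ℕ → ℕ
doubleFact k = 2 ^ (k ∸ 1) ℕ.* (k ∸ 1) !

divDF : ℤ → ℕ → ℚ
divDF z k = (z / doubleFact k) {{m*n≢0 (2 ^ (k ∸ 1)) ((k ∸ 1) !) {{m^n≢0 2 (k ∸ 1)}} {{(k ∸ 1) !≢0}}}}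

-- integer polynomials as ascending coefficient lists a₀ ∷ a₁ ∷ …
evalPoly : List ℤ → ℤ → ℤ
evalPoly [] x = + 0
evalPoly (a ∷ as) x = a ℤ.+ x ℤ.* evalPoly as x

HasDegree : List ℤ → ℕ → Set
HasDegree cs d = (length cs ≡ suc d) × (∀ a → last cs ≡ just a → a ≢ + 0)

-- With N = n − 1 + 2k and S(N, k) = 2ᴺ − 2 Σ_{i<k} C(N, i), one shows P_n(k) = c_n(k) S(N, k) / 2ᵏ
-- by induction on n, for all k at once. For n = 1, 2 one has S(N, k) = n C(N, k), and the claim
-- becomes a telescoping product of ratios of consecutive central binomial coefficients. In the step
-- n → n + 1 the defining recursion is divided by c_n(k); what remains is the Pascal-rule
-- recurrence 4(n + k) S(N + 1, k) = 4(n + k) S(N, k) + (n + k) S(N + 2, k + 1) + 2(4k + n) C(N, k),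
-- once the ratios c_n(k + 1)/c_n(k), c_{n+1}(k)/c_n(k) are computed and the extra term is
-- recognised as ℓ_n(k) = c_n(k) C(N, k) / 2ᵏ (n odd), resp. ℓ_{n−1}(k) = 2 c_n(k) C(N, k) / 2ᵏ
-- (n even). Finally 2ⁿ⁺ᵏ⁻¹ − S(N, k) / 2ᵏ = (k − 1)! Σ_{i<k} C(N, i) / (2k − 2)!!, and the
-- numerator is a monic integer polynomial of degree k − 1 in n.

module Submission where

open import Data.Bool using (true; false; if_then_else_)
open import Data.Bool.Properties using (if-cong)
open import Data.Nat as ℕ using (ℕ; zero; suc; _+_; _*_; _^_; _∸_; ⌊_/2⌋; _!; _≤_; _<_; s≤s; z≤n)
import Data.Nat.Properties as ℕP
open import Data.Integer as ℤ using (ℤ; +_)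
import Data.Integer.Properties as ℤP
open import Data.Rational as ℚ using (ℚ)
import Data.Rational.Properties as ℚP
import Data.Rational.Unnormalised as ℚᵘ
import Data.Rational.Unnormalised.Properties as ℚᵘP
open import Data.Product using (Σ; _,_; _×_)
open import Data.List using (List; []; _∷_; length; last; map)
import Data.List.Properties as ListP
open import Data.Maybe using (just)
import Data.Maybe.Properties as MaybeP
open import Relation.Binary.PropositionalEquality
open import Algebra.Properties.AbelianGroup ℤP.+-0-abelianGroup using (∙-cancelʳ)
import Data.Nat.Tactic.RingSolver as ℕ-Solver
import Data.Integer.Tactic.RingSolver as ℤ-Solver
open import Tactic.RingSolver using (solve-∀)
open import Tactic.RingSolver.Core.AlmostCommutativeRing using (AlmostCommutativeRing; fromCommutativeRing)
open import Data.Maybe using (nothing)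
open import Level using (0ℓ)
open import Defs

open ≡-Reasoning


infix 5 _/suc_
_/suc_ : ℤ → ℕ → ℚ
a /suc d = a ℚ./ suc d

private
  fromℚᵘ-homo-+ : ∀ x y → ℚ.fromℚᵘ x ℚ.+ ℚ.fromℚᵘ y ≡ ℚ.fromℚᵘ (x ℚᵘ.+ y)
  fromℚᵘ-homo-+ x y = ℚP.toℚᵘ-injective
    (ℚᵘP.≃-trans (ℚP.toℚᵘ-homo-+ (ℚ.fromℚᵘ x) (ℚ.fromℚᵘ y))
    (ℚᵘP.≃-trans (ℚᵘP.+-cong (ℚP.toℚᵘ-fromℚᵘ x) (ℚP.toℚᵘ-fromℚᵘ y))
                 (ℚᵘP.≃-sym (ℚP.toℚᵘ-fromℚᵘ (x ℚᵘ.+ y)))))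

  fromℚᵘ-homo-* : ∀ x y → ℚ.fromℚᵘ x ℚ.* ℚ.fromℚᵘ y ≡ ℚ.fromℚᵘ (x ℚᵘ.* y)
  fromℚᵘ-homo-* x y = ℚP.toℚᵘ-injective
    (ℚᵘP.≃-trans (ℚP.toℚᵘ-homo-* (ℚ.fromℚᵘ x) (ℚ.fromℚᵘ y))
    (ℚᵘP.≃-trans (ℚᵘP.*-cong (ℚP.toℚᵘ-fromℚᵘ x) (ℚP.toℚᵘ-fromℚᵘ y))
                 (ℚᵘP.≃-sym (ℚP.toℚᵘ-fromℚᵘ (x ℚᵘ.* y)))))

  fromℚᵘ-homo-neg : ∀ x → ℚ.- ℚ.fromℚᵘ x ≡ ℚ.fromℚᵘ (ℚᵘ.- x)
  fromℚᵘ-homo-neg x = ℚP.toℚᵘ-injective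
    (ℚᵘP.≃-trans (ℚP.toℚᵘ-homo‿- (ℚ.fromℚᵘ x))
    (ℚᵘP.≃-trans (ℚᵘP.-‿cong (ℚP.toℚᵘ-fromℚᵘ x))
                 (ℚᵘP.≃-sym (ℚP.toℚᵘ-fromℚᵘ (ℚᵘ.- x)))))

/suc-cong : ∀ {a a′ d d′} → a ≡ a′ → suc d ≡ suc d′ → a /suc d ≡ a′ /suc d′
/suc-cong refl refl = refl

/suc-cross : ∀ a b c d → a ℤ.* + suc d ≡ c ℤ.* + suc b → a /suc b ≡ c /suc d
/suc-cross a b c d e = ℚP.fromℚᵘ-cong {ℚᵘ.mkℚᵘ a b} {ℚᵘ.mkℚᵘ c d} (ℚᵘ.*≡* e)

-- A fraction whose denominator is also carried as an integer expression, so that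
-- cross-multiplied identities between fractions are ring identities in ℤ. Such identities
-- are stated below verbatim in the shape `normal` produces, hence their spurious factors + 1.
record Frac : Set where
  constructor frac
  field
    num : ℤ
    den-1 : ℕ
    den : ℤ
    den≡ : + suc den-1 ≡ den
open Frac

⟦_⟧ : Frac → ℚ
⟦ x ⟧ = num x /suc den-1 x

int : ℤ → Frac
int a = frac a 0 (+ 1) refl

private
  den-* : ∀ b d B D → + suc b ≡ B → + suc d ≡ D → + suc (d + b * suc d) ≡ B ℤ.* D
  den-* b d B D pb pd = trans (ℤP.pos-* (suc b) (suc d)) (cong₂ ℤ._*_ pb pd)

_⊕_ : Frac → Frac → Frac
x ⊕ y = frac (num x ℤ.* den y ℤ.+ num y ℤ.* den x) (den-1 y + den-1 x * suc (den-1 y)) (den x ℤ.* den y)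
             (den-* (den-1 x) (den-1 y) (den x) (den y) (den≡ x) (den≡ y))

_⊗_ : Frac → Frac → Frac
x ⊗ y = frac (num x ℤ.* num y) (den-1 y + den-1 x * suc (den-1 y)) (den x ℤ.* den y)
             (den-* (den-1 x) (den-1 y) (den x) (den y) (den≡ x) (den≡ y))

⊖_ : Frac → Frac
⊖ x = frac (ℤ.- num x) (den-1 x) (den x) (den≡ x)

⟦⟧-⊕ : ∀ x y → ⟦ x ⟧ ℚ.+ ⟦ y ⟧ ≡ ⟦ x ⊕ y ⟧
⟦⟧-⊕ (frac a b _ refl) (frac c d _ refl) = fromℚᵘ-homo-+ (ℚᵘ.mkℚᵘ a b) (ℚᵘ.mkℚᵘ c d)

⟦⟧-⊗ : ∀ x y → ⟦ x ⟧ ℚ.* ⟦ y ⟧ ≡ ⟦ x ⊗ y ⟧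
⟦⟧-⊗ (frac a b _ _) (frac c d _ _) = fromℚᵘ-homo-* (ℚᵘ.mkℚᵘ a b) (ℚᵘ.mkℚᵘ c d)

⟦⟧-⊖ : ∀ x → ℚ.- ⟦ x ⟧ ≡ ⟦ ⊖ x ⟧
⟦⟧-⊖ (frac a b _ _) = fromℚᵘ-homo-neg (ℚᵘ.mkℚᵘ a b)

⟦⟧-cross : ∀ x y → num x ℤ.* den y ≡ num y ℤ.* den x → ⟦ x ⟧ ≡ ⟦ y ⟧
⟦⟧-cross (frac a b _ refl) (frac c d _ refl) = /suc-cross a b c d

infixl 6 _:+_
infixl 7 _:*_
data FracExpr : Set where
  leaf : Frac → FracExpr
  _:+_ _:*_ : FracExpr → FracExpr → FracExpr
  neg : FracExpr → FracExpr

evalℚ : FracExpr → ℚ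
evalℚ (leaf x) = ⟦ x ⟧
evalℚ (a :+ b) = evalℚ a ℚ.+ evalℚ b
evalℚ (a :* b) = evalℚ a ℚ.* evalℚ b
evalℚ (neg a) = ℚ.- evalℚ a

normal : FracExpr → Frac
normal (leaf x) = x
normal (a :+ b) = normal a ⊕ normal b
normal (a :* b) = normal a ⊗ normal b
normal (neg a) = ⊖ normal a

normal-sound : ∀ e → evalℚ e ≡ ⟦ normal e ⟧
normal-sound (leaf x) = refl
normal-sound (a :+ b) = trans (cong₂ ℚ._+_ (normal-sound a) (normal-sound b)) (⟦⟧-⊕ (normal a) (normal b))
normal-sound (a :* b) = trans (cong₂ ℚ._*_ (normal-sound a) (normal-sound b)) (⟦⟧-⊗ (normal a) (normal b))
normal-sound (neg a) = trans (cong ℚ.-_ (normal-sound a)) (⟦⟧-⊖ (normal a))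

by-cross-multiplication : ∀ e₁ e₂ →
  num (normal e₁) ℤ.* den (normal e₂) ≡ num (normal e₂) ℤ.* den (normal e₁) → evalℚ e₁ ≡ evalℚ e₂
by-cross-multiplication e₁ e₂ eq =
  trans (normal-sound e₁) (trans (⟦⟧-cross (normal e₁) (normal e₂) eq) (sym (normal-sound e₂)))

ℕtoℚ≡int : ∀ n {A} → + n ≡ A → ℕtoℚ n ≡ ⟦ int A ⟧
ℕtoℚ≡int n refl = refl

linear-combination : ∀ {L R a b : ℤ} t → a ≡ b → L ℤ.+ t ℤ.* b ≡ R ℤ.+ t ℤ.* a → L ≡ R
linear-combination {L} {R} {a} t refl e = ∙-cancelʳ (t ℤ.* a) L R e

ℚ-ring : AlmostCommutativeRing 0ℓ 0ℓ
ℚ-ring = fromCommutativeRing ℚP.+-*-commutativeRing (λ _ → nothing)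

binom : ℕ → ℕ → ℕ
binom n zero = 1
binom zero (suc k) = 0
binom (suc n) (suc k) = binom n k + binom n (suc k)

binom-1 : ∀ n → binom n 1 ≡ n
binom-1 zero = refl
binom-1 (suc n) = cong suc (binom-1 n)

binom-absorption : ∀ n k → suc k * binom (suc n) (suc k) ≡ suc n * binom n k
binom-absorption zero zero = refl
binom-absorption zero (suc k) = ℕP.*-zeroʳ (suc (suc k))
binom-absorption (suc n) zero = cong suc (trans (ℕP.+-identityʳ (binom (suc n) 1))
  (trans (binom-1 (suc n)) (sym (ℕP.*-identityʳ (suc n)))))
binom-absorption (suc n) (suc k) = begin
  suc (suc k) * (a + b + Y)                   ≡⟨ split (suc k) a b Y ⟩
  (a + b) + suc k * (a + b) + suc (suc k) * Y ≡⟨ cong₂ (λ u v → (a + b) + u + v)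
                                                    (binom-absorption n k) (binom-absorption n (suc k)) ⟩
  (a + b) + suc n * a + suc n * b             ≡⟨ join (suc n) a b ⟩
  suc (suc n) * (a + b)                       ∎
  where
  a = binom n k
  b = binom n (suc k)
  Y = binom (suc n) (suc (suc k))
  split : ∀ i a b Y → suc i * ((a + b) + Y) ≡ (a + b) + i * (a + b) + suc i * Y
  split = ℕ-Solver.solve-∀
  join : ∀ m a b → (a + b) + m * a + m * b ≡ suc m * (a + b)
  join = ℕ-Solver.solve-∀

binom-ratio : ∀ a k → suc k * binom (a + k) (suc k) ≡ a * binom (a + k) k
binom-ratio a k = ℕP.+-cancelˡ-≡ (suc k * binom (a + k) k) _ _ (begin
  suc k * binom (a + k) k + suc k * binom (a + k) (suc k) ≡⟨ ℕP.*-distribˡ-+ (suc k) (binom (a + k) k) _ ⟨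
  suc k * binom (suc (a + k)) (suc k)                     ≡⟨ binom-absorption (a + k) k ⟩
  suc (a + k) * binom (a + k) k                           ≡⟨ split a k (binom (a + k) k) ⟩
  suc k * binom (a + k) k + a * binom (a + k) k           ∎)
  where
  split : ∀ a k X → suc (a + k) * X ≡ suc k * X + a * X
  split = ℕ-Solver.solve-∀

binomSum : ℕ → ℕ → ℕ
binomSum n zero = 0
binomSum n (suc k) = binomSum n k + binom n k

binomSum-pascal : ∀ n k → binomSum (suc n) (suc k) ≡ binomSum n (suc k) + binomSum n k
binomSum-pascal n zero = refl
binomSum-pascal n (suc k) = begin
  binomSum (suc n) (suc k) + (binom n k + binom n (suc k))
    ≡⟨ cong (_+ (binom n k + binom n (suc k))) (binomSum-pascal n k) ⟩
  (binomSum n (suc k) + binomSum n k) + (binom n k + binom n (suc k))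
    ≡⟨ regroup (binomSum n k) (binom n k) (binom n (suc k)) ⟩
  (binomSum n (suc k) + binom n (suc k)) + (binomSum n k + binom n k) ∎
  where
  regroup : ∀ x y z → ((x + y) + x) + (y + z) ≡ ((x + y) + z) + (x + y)
  regroup = ℕ-Solver.solve-∀

-- 2ᴺ − 2 Σ_{i<k} C(N,i) = Σ_{k ≤ i ≤ N−k} C(N,i)
centralSum : ℕ → ℕ → ℤ
centralSum N k = + (2 ^ N) ℤ.- + 2 ℤ.* + binomSum N k

centralSum-pascal : ∀ N j → centralSum (suc N) (suc j) ≡
  + 2 ℤ.* + (2 ^ N) ℤ.- + 2 ℤ.* ((+ binomSum N j ℤ.+ + binom N j) ℤ.+ + binomSum N j)
centralSum-pascal N j = cong₂ (λ u v → u ℤ.- + 2 ℤ.* v) (ℤP.pos-* 2 (2 ^ N)) (cong +_ (binomSum-pascal N j))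

centralSum-pascal² : ∀ N j → centralSum (suc (suc N)) (suc (suc j)) ≡
  + 2 ℤ.* (+ 2 ℤ.* + (2 ^ N)) ℤ.-
  + 2 ℤ.* (((+ binomSum N j ℤ.+ + binom N j ℤ.+ + binom N (suc j)) ℤ.+ (+ binomSum N j ℤ.+ + binom N j))
           ℤ.+ ((+ binomSum N j ℤ.+ + binom N j) ℤ.+ + binomSum N j))
centralSum-pascal² N j = cong₂ (λ u v → u ℤ.- + 2 ℤ.* v)
  (trans (ℤP.pos-* 2 (2 * 2 ^ N)) (cong (+ 2 ℤ.*_) (ℤP.pos-* 2 (2 ^ N))))
  (cong +_ (trans (binomSum-pascal (suc N) (suc j)) (cong₂ _+_ (binomSum-pascal N (suc j)) (binomSum-pascal N j))))

-- The row of Pascal's triangle attached to P_{m+1}(k): N = n − 1 + 2k.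
row : ℕ → ℕ → ℕ
row m k = m + (k + k)

row-suc : ∀ m k → row m (suc k) ≡ suc (suc (row m k))
row-suc = unfolded
  where
  unfolded : ∀ m k → m + (suc k + suc k) ≡ suc (suc (m + (k + k)))
  unfolded = ℕ-Solver.solve-∀

private
  recurrence-identity : ∀ P X C₀ C₁ ν κ → κ ℤ.* C₁ ≡ (ν ℤ.+ κ) ℤ.* C₀ →
    + 4 ℤ.* (ν ℤ.+ κ) ℤ.* (+ 2 ℤ.* P ℤ.- + 2 ℤ.* ((X ℤ.+ C₀) ℤ.+ X)) ≡
      + 4 ℤ.* (ν ℤ.+ κ) ℤ.* (P ℤ.- + 2 ℤ.* (X ℤ.+ C₀))
      ℤ.+ (ν ℤ.+ κ) ℤ.* (+ 2 ℤ.* (+ 2 ℤ.* P) ℤ.- + 2 ℤ.* (((X ℤ.+ C₀ ℤ.+ C₁) ℤ.+ (X ℤ.+ C₀)) ℤ.+ ((X ℤ.+ C₀) ℤ.+ X)))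
      ℤ.+ + 2 ℤ.* (+ 4 ℤ.* κ ℤ.+ ν) ℤ.* C₁
  recurrence-identity P X C₀ C₁ ν κ h =
    linear-combination (ℤ.- + 6) h (ℤ-Solver.solve (P ∷ X ∷ C₀ ∷ C₁ ∷ ν ∷ κ ∷ []))

centralSum-recurrence : ∀ m j → let k = suc j ; N = row m k ; ν = + suc m ; κ = + k in
  + 4 ℤ.* (ν ℤ.+ κ) ℤ.* centralSum (suc N) k ≡
    + 4 ℤ.* (ν ℤ.+ κ) ℤ.* centralSum N k
    ℤ.+ (ν ℤ.+ κ) ℤ.* centralSum (row m (suc k)) (suc k)
    ℤ.+ + 2 ℤ.* (+ 4 ℤ.* κ ℤ.+ ν) ℤ.* + binom N k
centralSum-recurrence m j
  rewrite row-suc m (suc j) | centralSum-pascal² (row m (suc j)) j | centralSum-pascal (row m (suc j)) j =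
  recurrence-identity (+ (2 ^ N)) (+ binomSum N j) (+ binom N j) (+ binom N (suc j)) (+ suc m) (+ suc j) ratio
  where
  N = row m (suc j)
  ratioℕ : suc j * binom N (suc j) ≡ (suc m + suc j) * binom N j
  ratioℕ = subst (λ z → suc j * binom z (suc j) ≡ (suc m + suc j) * binom z j)
    (shift m j) (binom-ratio (suc m + suc j) j)
    where
    shift : ∀ m j → (suc m + suc j) + j ≡ m + (suc j + suc j)
    shift = ℕ-Solver.solve-∀
  ratio : + suc j ℤ.* + binom N (suc j) ≡ (+ suc m ℤ.+ + suc j) ℤ.* + binom N j
  ratio = trans (sym (ℤP.pos-* (suc j) (binom N (suc j))))
    (trans (cong +_ ratioℕ) (ℤP.pos-* (suc m + suc j) (binom N j)))

binom-centre-symm : ∀ j → binom (suc j + suc j) (suc (suc j)) ≡ binom (suc j + suc j) j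
binom-centre-symm j = ℕP.*-cancelˡ-≡ _ _ (suc (suc j)) (trans (binom-ratio (suc j) (suc j)) (sym shifted))
  where
  shifted : suc (suc j) * binom (suc j + suc j) j ≡ suc j * binom (suc j + suc j) (suc j)
  shifted = sym (subst (λ z → suc j * binom z (suc j) ≡ suc (suc j) * binom z j)
    (sym (ℕP.+-suc (suc j) j)) (binom-ratio (suc (suc j)) j))

private
  centre-identity : ∀ P X C₀ C₁ → P ℤ.- + 2 ℤ.* (X ℤ.+ C₀) ≡ C₁ →
    + 2 ℤ.* (+ 2 ℤ.* P) ℤ.- + 2 ℤ.* (((X ℤ.+ C₀ ℤ.+ C₁) ℤ.+ (X ℤ.+ C₀)) ℤ.+ ((X ℤ.+ C₀) ℤ.+ X)) ≡
    (C₀ ℤ.+ C₁) ℤ.+ (C₁ ℤ.+ C₀)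
  centre-identity P X C₀ C₁ h = linear-combination (+ 4) h (ℤ-Solver.solve (P ∷ X ∷ C₀ ∷ C₁ ∷ []))

  centre-identity-odd : ∀ P X C₀ C₁ → P ℤ.- + 2 ℤ.* (X ℤ.+ C₀) ≡ C₁ →
    + 2 ℤ.* P ℤ.- + 2 ℤ.* ((X ℤ.+ C₀) ℤ.+ X) ≡ + 2 ℤ.* (C₀ ℤ.+ C₁)
  centre-identity-odd P X C₀ C₁ h = linear-combination (+ 2) h (ℤ-Solver.solve (P ∷ X ∷ C₀ ∷ C₁ ∷ []))

centralSum-centre : ∀ j → centralSum (suc j + suc j) (suc j) ≡ + binom (suc j + suc j) (suc j)
centralSum-centre zero = refl
centralSum-centre (suc j) = subst (λ z → centralSum z (suc (suc j)) ≡ + binom z (suc (suc j)))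
  (sym (cong suc (ℕP.+-suc (suc j) (suc j))))
  (trans (centralSum-pascal² N j)
  (trans (centre-identity (+ (2 ^ N)) (+ binomSum N j) (+ binom N j) (+ binom N (suc j)) (centralSum-centre j))
         (cong (λ z → (+ binom N j ℤ.+ + binom N (suc j)) ℤ.+ (+ binom N (suc j) ℤ.+ + z))
               (sym (binom-centre-symm j)))))
  where N = suc j + suc j

centralSum-centre-odd : ∀ j →
  centralSum (suc (suc j + suc j)) (suc j) ≡ + 2 ℤ.* + binom (suc (suc j + suc j)) (suc j)
centralSum-centre-odd j = trans (centralSum-pascal N j)
  (centre-identity-odd (+ (2 ^ N)) (+ binomSum N j) (+ binom N j) (+ binom N (suc j)) (centralSum-centre j))
  where N = suc j + suc j

data Parity : ℕ → Set where
  even : ∀ h → Parity (h + h)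
  odd  : ∀ h → Parity (h + suc h)

parity : ∀ n → Parity n
parity zero = even 0
parity (suc n) with parity n
... | even h = subst Parity (ℕP.+-suc h h) (odd h)
... | odd h = even (suc h)

isOdd-suc-suc : ∀ n → isOdd (suc (suc n)) ≡ isOdd n
isOdd-suc-suc n with isOdd n
... | true = refl
... | false = refl

isOdd-even : ∀ h → isOdd (h + h) ≡ false
isOdd-even zero = refl
isOdd-even (suc h) = trans (cong isOdd (cong suc (ℕP.+-suc h h))) (trans (isOdd-suc-suc (h + h)) (isOdd-even h))

isOdd-odd : ∀ h → isOdd (suc (h + h)) ≡ true
isOdd-odd zero = refl
isOdd-odd (suc h) = trans (cong isOdd (cong suc (cong suc (ℕP.+-suc h h))))
  (trans (isOdd-suc-suc (suc (h + h))) (isOdd-odd h))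

⌊even/2⌋ : ∀ h → ⌊ h + h /2⌋ ≡ h
⌊even/2⌋ zero = refl
⌊even/2⌋ (suc h) = trans (cong ⌊_/2⌋ (cong suc (ℕP.+-suc h h))) (cong suc (⌊even/2⌋ h))

⌊odd/2⌋ : ∀ h → ⌊ suc (h + h) /2⌋ ≡ h
⌊odd/2⌋ zero = refl
⌊odd/2⌋ (suc h) = trans (cong ⌊_/2⌋ (cong suc (cong suc (ℕP.+-suc h h)))) (cong suc (⌊odd/2⌋ h))

½ : ℚ
½ = + 1 /suc 1

c-odd : ∀ h k → c (suc (h + h)) k ≡ ℕtoℚ (h !) ℚ.* oddProd (suc (h + h)) (k ∸ 1)
c-odd h k = cong₂ (λ b t → if b then ℕtoℚ (t !) ℚ.* oddProd (suc (h + h)) (k ∸ 1)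
                           else ½ ℚ.* ℕtoℚ ((t ∸ 1) !) ℚ.* evenProd (suc (h + h)) k)
                  (isOdd-odd h) (⌊odd/2⌋ h)

c-even : ∀ h k → c (suc (suc (h + h))) k ≡ (½ ℚ.* ℕtoℚ (h !)) ℚ.* evenProd (suc (suc (h + h))) k
c-even h k = cong₂ (λ b t → if b then ℕtoℚ (t !) ℚ.* oddProd (suc (suc (h + h))) (k ∸ 1)
                            else ½ ℚ.* ℕtoℚ ((t ∸ 1) !) ℚ.* evenProd (suc (suc (h + h))) k)
                   (trans (isOdd-suc-suc (h + h)) (isOdd-even h)) (cong suc (⌊even/2⌋ h))

c-odd-suc : ∀ h j → let n = suc (h + h) in
  c n (suc (suc j)) ≡ c n (suc j) ℚ.* ((+ (n + suc j)) ℚ./ (2 * suc j + n))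
c-odd-suc h j = trans (c-odd h (suc (suc j)))
  (trans (sym (ℚP.*-assoc (ℕtoℚ (h !)) (oddProd n j) _))
         (cong (ℚ._* ((+ (n + suc j)) ℚ./ (2 * suc j + n))) (sym (c-odd h (suc j)))))
  where n = suc (h + h)

c-even-suc : ∀ h k → let n = suc (suc (h + h)) in
  c n (suc k) ≡ c n k ℚ.* ((+ (n + k)) ℚ./ suc (n + 2 * k))
c-even-suc h k = trans (c-even h (suc k))
  (trans (sym (ℚP.*-assoc (½ ℚ.* ℕtoℚ (h !)) (evenProd n k) _))
         (cong (ℚ._* ((+ (n + k)) ℚ./ suc (n + 2 * k))) (sym (c-even h k))))
  where n = suc (suc (h + h))

ℕtoℚ-* : ∀ a b → ℕtoℚ (a * b) ≡ ℕtoℚ a ℚ.* ℕtoℚ b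
ℕtoℚ-* a b = sym (trans (fromℚᵘ-homo-* (ℚᵘ.mkℚᵘ (+ a) 0) (ℚᵘ.mkℚᵘ (+ b) 0))
                        (cong (_/suc 0) (sym (ℤP.pos-* a b))))

ℕtoℚ-half : ∀ h → ℕtoℚ (suc h) ≡ ½ ℚ.* ℕtoℚ (suc (suc (h + h)))
ℕtoℚ-half h = by-cross-multiplication (leaf (int (+ 1 ℤ.+ + h)))
  (leaf (frac (+ 1) 1 (+ 2) refl) :* leaf (int (+ 2 ℤ.+ (+ h ℤ.+ + h)))) (identity (+ h))
  where
  identity : ∀ η → (+ 1 ℤ.+ η) ℤ.* (+ 2 ℤ.* + 1) ≡ (+ 1 ℤ.* (+ 2 ℤ.+ (η ℤ.+ η))) ℤ.* + 1
  identity = ℤ-Solver.solve-∀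

evenProd-suc : ∀ n j → evenProd (suc n) (suc j) ≡ oddProd n j ℚ.* ((+ (n + suc j)) ℚ./ (2 * suc j + n))
evenProd-suc n zero = cong (ℕtoℚ 1 ℚ.*_) (/suc-cong (cong +_ (numerator≡ n)) (denominator≡ n))
  where
  numerator≡ : ∀ n → suc n + 0 ≡ n + 1
  numerator≡ = ℕ-Solver.solve-∀
  denominator≡ : ∀ n → suc (suc n + 2 * 0) ≡ 2 * 1 + n
  denominator≡ = ℕ-Solver.solve-∀
evenProd-suc n (suc j) = cong₂ ℚ._*_ (evenProd-suc n j) (/suc-cong (cong +_ (numerator≡ n j)) (denominator≡ n j))
  where
  numerator≡ : ∀ n j → suc n + suc j ≡ n + suc (suc j)
  numerator≡ = ℕ-Solver.solve-∀
  denominator≡ : ∀ n j → suc (suc n + 2 * suc j) ≡ 2 * suc (suc j) + n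
  denominator≡ = ℕ-Solver.solve-∀

oddProd-suc : ∀ n j → ℕtoℚ n ℚ.* oddProd (suc n) j ≡ ℕtoℚ (n + suc j) ℚ.* evenProd n (suc j)
oddProd-suc n zero = by-cross-multiplication
  (leaf (int (+ n)) :* leaf (int (+ 1)))
  (leaf (int (+ n ℤ.+ + 1)) :* (leaf (int (+ 1)) :*
     leaf (frac (+ n ℤ.+ + 0) (n + 2 * 0) (+ n ℤ.+ + 1) (cong +_ (denominator≡ n)))))
  (identity (+ n))
  where
  denominator≡ : ∀ n → suc (n + 2 * 0) ≡ n + 1
  denominator≡ = ℕ-Solver.solve-∀
  identity : ∀ ν → (ν ℤ.* + 1) ℤ.* (+ 1 ℤ.* (+ 1 ℤ.* (ν ℤ.+ + 1))) ≡
                   ((ν ℤ.+ + 1) ℤ.* (+ 1 ℤ.* (ν ℤ.+ + 0))) ℤ.* (+ 1 ℤ.* + 1)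
  identity = ℤ-Solver.solve-∀
oddProd-suc n (suc j) = begin
  ℕtoℚ n ℚ.* (oddProd (suc n) j ℚ.* o)             ≡⟨ ℚP.*-assoc (ℕtoℚ n) _ o ⟨
  (ℕtoℚ n ℚ.* oddProd (suc n) j) ℚ.* o             ≡⟨ cong (ℚ._* o) (oddProd-suc n j) ⟩
  (ℕtoℚ (n + suc j) ℚ.* E) ℚ.* o                   ≡⟨ swap₁ (ℕtoℚ (n + suc j)) E o ⟩
  E ℚ.* (ℕtoℚ (n + suc j) ℚ.* o)                   ≡⟨ cong (E ℚ.*_) factor-step ⟩
  E ℚ.* (ℕtoℚ (n + suc (suc j)) ℚ.* e)             ≡⟨ swap₂ (ℕtoℚ (n + suc (suc j))) E e ⟩
  ℕtoℚ (n + suc (suc j)) ℚ.* (E ℚ.* e)             ∎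
  where
  E = evenProd n (suc j)
  o = (+ (suc n + suc j)) ℚ./ (2 * suc j + suc n)
  e = (+ (n + suc j)) ℚ./ suc (n + 2 * suc j)
  swap₁ : ∀ a E o → (a ℚ.* E) ℚ.* o ≡ E ℚ.* (a ℚ.* o)
  swap₁ = solve-∀ ℚ-ring
  swap₂ : ∀ b E e → E ℚ.* (b ℚ.* e) ≡ b ℚ.* (E ℚ.* e)
  swap₂ = solve-∀ ℚ-ring
  ν = + n
  κ = + j
  identity : ∀ ν κ →
    ((ν ℤ.+ (+ 1 ℤ.+ κ)) ℤ.* ((+ 1 ℤ.+ ν) ℤ.+ (+ 1 ℤ.+ κ))) ℤ.* (+ 1 ℤ.* ((ν ℤ.+ (+ 2 ℤ.* (+ 1 ℤ.+ κ))) ℤ.+ + 1)) ≡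
    ((ν ℤ.+ (+ 2 ℤ.+ κ)) ℤ.* (ν ℤ.+ (+ 1 ℤ.+ κ))) ℤ.* (+ 1 ℤ.* ((+ 2 ℤ.* (+ 1 ℤ.+ κ)) ℤ.+ (+ 1 ℤ.+ ν)))
  identity = ℤ-Solver.solve-∀
  factor-step : ℕtoℚ (n + suc j) ℚ.* o ≡ ℕtoℚ (n + suc (suc j)) ℚ.* e
  factor-step = by-cross-multiplication
    (leaf (int (ν ℤ.+ (+ 1 ℤ.+ κ))) :*
     leaf (frac ((+ 1 ℤ.+ ν) ℤ.+ (+ 1 ℤ.+ κ)) (ℕ.pred (2 * suc j + suc n)) ((+ 2 ℤ.* (+ 1 ℤ.+ κ)) ℤ.+ (+ 1 ℤ.+ ν))
       (cong (ℤ._+ + suc n) (ℤP.pos-* 2 (suc j)))))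
    (leaf (int (ν ℤ.+ (+ 2 ℤ.+ κ))) :*
     leaf (frac (ν ℤ.+ (+ 1 ℤ.+ κ)) (n + 2 * suc j) ((ν ℤ.+ (+ 2 ℤ.* (+ 1 ℤ.+ κ))) ℤ.+ + 1)
       (trans (cong +_ (ℕP.+-comm 1 (n + 2 * suc j))) (cong (λ z → (ν ℤ.+ z) ℤ.+ + 1) (ℤP.pos-* 2 (suc j))))))
    (identity ν κ)

c-odd→even : ∀ h j → let n = suc (h + h) in
  c (suc n) (suc j) ≡ c n (suc j) ℚ.* (½ ℚ.* ((+ (n + suc j)) ℚ./ (2 * suc j + n)))
c-odd→even h j = begin
  c (suc n) (suc j)                                    ≡⟨ c-even h (suc j) ⟩
  (½ ℚ.* ℕtoℚ (h !)) ℚ.* evenProd (suc n) (suc j)     ≡⟨ cong ((½ ℚ.* ℕtoℚ (h !)) ℚ.*_) (evenProd-suc n j) ⟩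
  (½ ℚ.* ℕtoℚ (h !)) ℚ.* (oddProd n j ℚ.* r)          ≡⟨ swap ½ (ℕtoℚ (h !)) (oddProd n j) r ⟩
  (ℕtoℚ (h !) ℚ.* oddProd n j) ℚ.* (½ ℚ.* r)          ≡⟨ cong (ℚ._* (½ ℚ.* r)) (c-odd h (suc j)) ⟨
  c n (suc j) ℚ.* (½ ℚ.* r)                            ∎
  where
  n = suc (h + h)
  r = (+ (n + suc j)) ℚ./ (2 * suc j + n)
  swap : ∀ a b o r → (a ℚ.* b) ℚ.* (o ℚ.* r) ≡ (b ℚ.* o) ℚ.* (a ℚ.* r)
  swap = solve-∀ ℚ-ring

c-even→odd : ∀ h j → let n = suc (suc (h + h)) in
  c (suc n) (suc j) ≡ c n (suc j) ℚ.* ℕtoℚ (n + suc j)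
c-even→odd h j = begin
  c (suc n) (suc j)
    ≡⟨ cong (λ m → c m (suc j)) n+1≡ ⟩
  c (suc (suc h + suc h)) (suc j)
    ≡⟨ c-odd (suc h) (suc j) ⟩
  ℕtoℚ (suc h * h !) ℚ.* oddProd (suc (suc h + suc h)) j
    ≡⟨ cong (λ m → ℕtoℚ (suc h * h !) ℚ.* oddProd m j) n+1≡ ⟨
  ℕtoℚ (suc h * h !) ℚ.* oddProd (suc n) j
    ≡⟨ cong (ℚ._* oddProd (suc n) j) (ℕtoℚ-* (suc h) (h !)) ⟩
  (ℕtoℚ (suc h) ℚ.* ℕtoℚ (h !)) ℚ.* oddProd (suc n) j
    ≡⟨ cong (λ z → (z ℚ.* ℕtoℚ (h !)) ℚ.* oddProd (suc n) j) (ℕtoℚ-half h) ⟩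
  ((½ ℚ.* ℕtoℚ n) ℚ.* ℕtoℚ (h !)) ℚ.* oddProd (suc n) j
    ≡⟨ swap₁ ½ (ℕtoℚ (h !)) (ℕtoℚ n) (oddProd (suc n) j) ⟩
  (½ ℚ.* ℕtoℚ (h !)) ℚ.* (ℕtoℚ n ℚ.* oddProd (suc n) j)
    ≡⟨ cong ((½ ℚ.* ℕtoℚ (h !)) ℚ.*_) (oddProd-suc n j) ⟩
  (½ ℚ.* ℕtoℚ (h !)) ℚ.* (ℕtoℚ (n + suc j) ℚ.* evenProd n (suc j))
    ≡⟨ swap₂ ½ (ℕtoℚ (h !)) (ℕtoℚ (n + suc j)) (evenProd n (suc j)) ⟩
  ((½ ℚ.* ℕtoℚ (h !)) ℚ.* evenProd n (suc j)) ℚ.* ℕtoℚ (n + suc j)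
    ≡⟨ cong (ℚ._* ℕtoℚ (n + suc j)) (c-even h (suc j)) ⟨
  c n (suc j) ℚ.* ℕtoℚ (n + suc j) ∎
  where
  n = suc (suc (h + h))
  n+1≡ : suc n ≡ suc (suc h + suc h)
  n+1≡ = cong (λ m → suc (suc m)) (sym (ℕP.+-suc h h))
  swap₁ : ∀ a b x O → ((a ℚ.* x) ℚ.* b) ℚ.* O ≡ (a ℚ.* b) ℚ.* (x ℚ.* O)
  swap₁ = solve-∀ ℚ-ring
  swap₂ : ∀ a b y E → (a ℚ.* b) ℚ.* (y ℚ.* E) ≡ ((a ℚ.* b) ℚ.* E) ℚ.* y
  swap₂ = solve-∀ ℚ-ring

pred2^ : ℕ → ℕ
pred2^ zero = 0
pred2^ (suc k) = suc (pred2^ k + pred2^ k)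

suc-pred2^ : ∀ k → + suc (pred2^ k) ≡ + (2 ^ k)
suc-pred2^ zero = refl
suc-pred2^ (suc k) = cong +_ (begin
  suc (suc (pred2^ k + pred2^ k)) ≡⟨ cong suc (ℕP.+-suc (pred2^ k) (pred2^ k)) ⟨
  suc (pred2^ k) + suc (pred2^ k) ≡⟨ cong (λ x → suc (pred2^ k) + x) (ℕP.+-identityʳ (suc (pred2^ k))) ⟨
  2 * suc (pred2^ k)              ≡⟨ cong (2 *_) (ℤP.+-injective (suc-pred2^ k)) ⟩
  2 * 2 ^ k                       ∎)

suc-pred2^-suc : ∀ k → + suc (pred2^ (suc k)) ≡ + 2 ℤ.* + (2 ^ k)
suc-pred2^-suc k = trans (suc-pred2^ (suc k)) (ℤP.pos-* 2 (2 ^ k))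

-- The claimed value of P_{m+1}(k) / c_{m+1}(k).
closedForm : ℕ → ℕ → ℚ
closedForm m k = centralSum (row m k) k /suc pred2^ k

lprod-shift : ∀ t x → lprod t (suc x) * suc x ≡ (x + suc t) * lprod t x
lprod-shift zero x = ℕ-Solver.solve (x ∷ [])
lprod-shift (suc t) x = begin
  ((suc x + suc t) * lprod t (suc x)) * suc x ≡⟨ ℕP.*-assoc (suc x + suc t) (lprod t (suc x)) (suc x) ⟩
  (suc x + suc t) * (lprod t (suc x) * suc x) ≡⟨ cong ((suc x + suc t) *_) (lprod-shift t x) ⟩
  (suc x + suc t) * ((x + suc t) * lprod t x) ≡⟨ cong (_* ((x + suc t) * lprod t x)) (ℕP.+-suc x (suc t)) ⟨
  (x + suc (suc t)) * ((x + suc t) * lprod t x) ∎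

lprod-0 : ∀ t → lprod t 0 ≡ t !
lprod-0 zero = refl
lprod-0 (suc t) = cong (suc t *_) (lprod-0 t)

lprod-1 : ∀ t → lprod t 1 ≡ suc t * t !
lprod-1 t = trans (sym (ℕP.*-identityʳ (lprod t 1))) (trans (lprod-shift t 0) (cong (suc t *_) (lprod-0 t)))

lprod-suc : ∀ t x → ℕtoℚ (lprod t (suc x)) ≡ ℕtoℚ (lprod t x) ℚ.* (+ (x + suc t) /suc x)
lprod-suc t x = by-cross-multiplication (leaf (int (+ lprod t (suc x))))
  (leaf (int (+ lprod t x)) :* leaf (frac (+ (x + suc t)) x (+ suc x) refl))
  (identity (+ lprod t (suc x)) (+ lprod t x) (+ suc x) (+ (x + suc t)) shift)
  where
  identity : ∀ L′ L s a → L′ ℤ.* s ≡ a ℤ.* L → L′ ℤ.* (+ 1 ℤ.* s) ≡ (L ℤ.* a) ℤ.* + 1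
  identity L′ L s a h = linear-combination (+ 1) h (ℤ-Solver.solve (L′ ∷ L ∷ s ∷ a ∷ []))
  shift : + lprod t (suc x) ℤ.* + suc x ≡ + (x + suc t) ℤ.* + lprod t x
  shift = trans (sym (ℤP.pos-* (lprod t (suc x)) (suc x)))
    (trans (cong +_ (lprod-shift t x)) (ℤP.pos-* (x + suc t) (lprod t x)))

binom-two-rows : ∀ n a k N → a + k ≡ N → suc a ≡ n + k →
  (suc k * (n + k)) * binom (suc (suc N)) (suc k) ≡ (suc (suc N) * suc N) * binom N k
binom-two-rows n a k N refl a+1≡ = begin
  (suc k * (n + k)) * binom (suc (suc N)) (suc k) ≡⟨ swap₁ (suc k) (n + k) _ ⟩
  (n + k) * (suc k * binom (suc (suc N)) (suc k)) ≡⟨ cong ((n + k) *_) (binom-absorption (suc N) k) ⟩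
  (n + k) * (suc (suc N) * binom (suc N) k)       ≡⟨ swap₂ (n + k) (suc (suc N)) _ ⟩
  suc (suc N) * ((n + k) * binom (suc N) k)       ≡⟨ cong (suc (suc N) *_) shift ⟩
  suc (suc N) * (suc N * binom N k)               ≡⟨ ℕP.*-assoc (suc (suc N)) (suc N) _ ⟨
  (suc (suc N) * suc N) * binom N k               ∎
  where
  swap₁ : ∀ a b x → (a * b) * x ≡ b * (a * x)
  swap₁ = ℕ-Solver.solve-∀
  swap₂ : ∀ b y x → b * (y * x) ≡ y * (b * x)
  swap₂ = ℕ-Solver.solve-∀
  shift : (n + k) * binom (suc N) k ≡ suc N * binom N k
  shift = subst (λ w → w * binom (suc N) k ≡ suc N * binom N k) a+1≡
    (trans (sym (binom-ratio (suc a) k)) (binom-absorption N k))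

binom-two-rowsℤ : ∀ n a k N → a + k ≡ N → suc a ≡ n + k →
  (+ suc k ℤ.* + (n + k)) ℤ.* + binom (suc (suc N)) (suc k) ≡ (+ suc (suc N) ℤ.* + suc N) ℤ.* + binom N k
binom-two-rowsℤ n a k N a+k≡ a+1≡ = trans (sym (pos-*³ (suc k) (n + k) _))
  (trans (cong +_ (binom-two-rows n a k N a+k≡ a+1≡)) (pos-*³ (suc (suc N)) (suc N) (binom N k)))
  where
  pos-*³ : ∀ a b d → + ((a * b) * d) ≡ (+ a ℤ.* + b) ℤ.* + d
  pos-*³ a b d = trans (ℤP.pos-* (a * b) d) (cong (ℤ._* + d) (ℤP.pos-* a b))

private
  ℓ-odd-identity : ∀ η κ E C C′ →
    ((+ 1 ℤ.+ κ) ℤ.* ((+ 1 ℤ.+ (η ℤ.+ η)) ℤ.+ κ)) ℤ.* C′ ≡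
      ((+ 2 ℤ.+ ((η ℤ.+ η) ℤ.+ (κ ℤ.+ κ))) ℤ.* (+ 1 ℤ.+ ((η ℤ.+ η) ℤ.+ (κ ℤ.+ κ)))) ℤ.* C →
    (C ℤ.* (κ ℤ.+ (+ 1 ℤ.+ η))) ℤ.* (((+ 2 ℤ.* κ) ℤ.+ (+ 1 ℤ.+ (η ℤ.+ η))) ℤ.* (+ 2 ℤ.* E)) ≡
      (((+ 1 ℤ.+ (η ℤ.+ η)) ℤ.+ κ) ℤ.* C′) ℤ.* (E ℤ.* (+ 1 ℤ.+ κ))
  ℓ-odd-identity η κ E C C′ h = linear-combination (ℤ.- E) h (ℤ-Solver.solve (η ∷ κ ∷ E ∷ C ∷ C′ ∷ []))

  ℓ-even-identity : ∀ η κ E C C′ →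
    ((+ 1 ℤ.+ κ) ℤ.* ((+ 2 ℤ.+ (η ℤ.+ η)) ℤ.+ κ)) ℤ.* C′ ≡
      ((+ 2 ℤ.+ ((+ 1 ℤ.+ (η ℤ.+ η)) ℤ.+ (κ ℤ.+ κ))) ℤ.* (+ 1 ℤ.+ ((+ 1 ℤ.+ (η ℤ.+ η)) ℤ.+ (κ ℤ.+ κ)))) ℤ.* C →
    ((+ 2 ℤ.* C) ℤ.* (κ ℤ.+ (+ 1 ℤ.+ η))) ℤ.* ((+ 1 ℤ.+ ((+ 2 ℤ.+ (η ℤ.+ η)) ℤ.+ (+ 2 ℤ.* κ))) ℤ.* (+ 2 ℤ.* E)) ≡
      (((+ 2 ℤ.+ (η ℤ.+ η)) ℤ.+ κ) ℤ.* (+ 2 ℤ.* C′)) ℤ.* (E ℤ.* (+ 1 ℤ.+ κ))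
  ℓ-even-identity η κ E C C′ h = linear-combination (ℤ.- (+ 2 ℤ.* E)) h (ℤ-Solver.solve (η ∷ κ ∷ E ∷ C ∷ C′ ∷ []))

ℓ-odd : ∀ h j → let n = suc (h + h) ; k = suc j in
  ℕtoℚ (lprod h k) ≡ c n k ℚ.* (+ binom (row (h + h) k) k /suc pred2^ k)
ℓ-odd h zero = begin
  ℕtoℚ (lprod h 1)                      ≡⟨ cong ℕtoℚ (lprod-1 h) ⟩
  ℕtoℚ (suc h * h !)                    ≡⟨ ℕtoℚ-* (suc h) (h !) ⟩
  ℕtoℚ (suc h) ℚ.* ℕtoℚ (h !)           ≡⟨ cong (ℚ._* ℕtoℚ (h !)) half ⟩
  (ℕtoℚ 1 ℚ.* X) ℚ.* ℕtoℚ (h !)         ≡⟨ swap (ℕtoℚ 1) X (ℕtoℚ (h !)) ⟩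
  (ℕtoℚ (h !) ℚ.* ℕtoℚ 1) ℚ.* X         ≡⟨ cong₂ ℚ._*_ (c-odd h 1) (cong (λ z → + z /suc 1) (binom-1 (row (h + h) 1))) ⟨
  c (suc (h + h)) 1 ℚ.* (+ binom (row (h + h) 1) 1 /suc 1) ∎
  where
  X = (+ h ℤ.+ + h) ℤ.+ + 2 /suc 1
  identity : ∀ η → (+ 1 ℤ.+ η) ℤ.* (+ 1 ℤ.* + 2) ≡ (+ 1 ℤ.* ((η ℤ.+ η) ℤ.+ + 2)) ℤ.* + 1
  identity = ℤ-Solver.solve-∀
  half : ℕtoℚ (suc h) ≡ ℕtoℚ 1 ℚ.* X
  half = by-cross-multiplication (leaf (int (+ 1 ℤ.+ + h)))
    (leaf (int (+ 1)) :* leaf (frac ((+ h ℤ.+ + h) ℤ.+ + 2) 1 (+ 2) refl)) (identity (+ h))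
  swap : ∀ a x b → (a ℚ.* x) ℚ.* b ≡ (b ℚ.* a) ℚ.* x
  swap = solve-∀ ℚ-ring
ℓ-odd h (suc j) = begin
  ℕtoℚ (lprod h (suc k))      ≡⟨ lprod-suc h k ⟩
  ℕtoℚ (lprod h k) ℚ.* A      ≡⟨ cong (ℚ._* A) (ℓ-odd h j) ⟩
  (c n k ℚ.* F) ℚ.* A         ≡⟨ ℚP.*-assoc (c n k) F A ⟩
  c n k ℚ.* (F ℚ.* A)         ≡⟨ cong (c n k ℚ.*_) shift ⟩
  c n k ℚ.* (r ℚ.* F′)        ≡⟨ ℚP.*-assoc (c n k) r F′ ⟨
  (c n k ℚ.* r) ℚ.* F′        ≡⟨ cong (ℚ._* F′) (c-odd-suc h j) ⟨
  c n (suc k) ℚ.* F′          ∎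
  where
  k = suc j
  n = suc (h + h)
  N = row (h + h) k
  N′ = row (h + h) (suc k)
  A = + (k + suc h) /suc k
  F = + binom N k /suc pred2^ k
  F′ = + binom N′ (suc k) /suc pred2^ (suc k)
  r = (+ (n + k)) ℚ./ (2 * k + n)
  η = + h
  κ = + k
  shift : F ℚ.* A ≡ r ℚ.* F′
  shift = by-cross-multiplication
    (leaf (frac (+ binom N k) (pred2^ k) (+ (2 ^ k)) (suc-pred2^ k)) :* leaf (frac (κ ℤ.+ (+ 1 ℤ.+ η)) k (+ 1 ℤ.+ κ) refl))
    (leaf (frac ((+ 1 ℤ.+ (η ℤ.+ η)) ℤ.+ κ) (ℕ.pred (2 * k + n)) ((+ 2 ℤ.* κ) ℤ.+ (+ 1 ℤ.+ (η ℤ.+ η)))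
            (cong (ℤ._+ (+ 1 ℤ.+ (η ℤ.+ η))) (ℤP.pos-* 2 k))) :*
     leaf (frac (+ binom N′ (suc k)) (pred2^ (suc k)) (+ 2 ℤ.* + (2 ^ k)) (suc-pred2^-suc k)))
    (ℓ-odd-identity η κ (+ (2 ^ k)) (+ binom N k) (+ binom N′ (suc k))
      (subst (λ z → (+ suc k ℤ.* + (n + k)) ℤ.* + binom z (suc k) ≡ (+ suc (suc N) ℤ.* + suc N) ℤ.* + binom N k) (sym (row-suc (h + h) k))
        (binom-two-rowsℤ n (h + h + k) k N (ℕP.+-assoc (h + h) k k) refl)))

ℓ-even : ∀ h k → let n = suc (suc (h + h)) in
  ℕtoℚ (lprod h k) ≡ c n k ℚ.* (+ 2 ℤ.* + binom (row (suc (h + h)) k) k /suc pred2^ k)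
ℓ-even h zero = begin
  ℕtoℚ (lprod h 0)                           ≡⟨ cong ℕtoℚ (lprod-0 h) ⟩
  ℕtoℚ (h !)                                 ≡⟨ ℚP.*-identityʳ (ℕtoℚ (h !)) ⟨
  ℕtoℚ (h !) ℚ.* ((½ ℚ.* ℕtoℚ 1) ℚ.* Y)      ≡⟨ swap ½ (ℕtoℚ (h !)) (ℕtoℚ 1) Y ⟩
  ((½ ℚ.* ℕtoℚ (h !)) ℚ.* ℕtoℚ 1) ℚ.* Y      ≡⟨ cong (ℚ._* Y) (c-even h 0) ⟨
  c (suc (suc (h + h))) 0 ℚ.* Y              ∎
  where
  Y = + 2 ℤ.* + 1 /suc 0
  swap : ∀ a x o Y → x ℚ.* ((a ℚ.* o) ℚ.* Y) ≡ ((a ℚ.* x) ℚ.* o) ℚ.* Y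
  swap = solve-∀ ℚ-ring
ℓ-even h (suc k) = begin
  ℕtoℚ (lprod h (suc k))      ≡⟨ lprod-suc h k ⟩
  ℕtoℚ (lprod h k) ℚ.* A      ≡⟨ cong (ℚ._* A) (ℓ-even h k) ⟩
  (c n k ℚ.* F) ℚ.* A         ≡⟨ ℚP.*-assoc (c n k) F A ⟩
  c n k ℚ.* (F ℚ.* A)         ≡⟨ cong (c n k ℚ.*_) shift ⟩
  c n k ℚ.* (r ℚ.* F′)        ≡⟨ ℚP.*-assoc (c n k) r F′ ⟨
  (c n k ℚ.* r) ℚ.* F′        ≡⟨ cong (ℚ._* F′) (c-even-suc h k) ⟨
  c n (suc k) ℚ.* F′          ∎
  where
  n = suc (suc (h + h))
  N = row (suc (h + h)) k
  N′ = row (suc (h + h)) (suc k)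
  A = + (k + suc h) /suc k
  F = + 2 ℤ.* + binom N k /suc pred2^ k
  F′ = + 2 ℤ.* + binom N′ (suc k) /suc pred2^ (suc k)
  r = (+ (n + k)) ℚ./ suc (n + 2 * k)
  η = + h
  κ = + k
  shift : F ℚ.* A ≡ r ℚ.* F′
  shift = by-cross-multiplication
    (leaf (frac (+ 2 ℤ.* + binom N k) (pred2^ k) (+ (2 ^ k)) (suc-pred2^ k)) :* leaf (frac (κ ℤ.+ (+ 1 ℤ.+ η)) k (+ 1 ℤ.+ κ) refl))
    (leaf (frac ((+ 2 ℤ.+ (η ℤ.+ η)) ℤ.+ κ) (n + 2 * k) (+ 1 ℤ.+ ((+ 2 ℤ.+ (η ℤ.+ η)) ℤ.+ (+ 2 ℤ.* κ)))
            (cong (λ z → + 1 ℤ.+ ((+ 2 ℤ.+ (η ℤ.+ η)) ℤ.+ z)) (ℤP.pos-* 2 k))) :*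
     leaf (frac (+ 2 ℤ.* + binom N′ (suc k)) (pred2^ (suc k)) (+ 2 ℤ.* + (2 ^ k)) (suc-pred2^-suc k)))
    (ℓ-even-identity η κ (+ (2 ^ k)) (+ binom N k) (+ binom N′ (suc k))
      (subst (λ z → (+ suc k ℤ.* + (n + k)) ℤ.* + binom z (suc k) ≡ (+ suc (suc N) ℤ.* + suc N) ℤ.* + binom N k) (sym (row-suc (suc (h + h)) k))
        (binom-two-rowsℤ n (suc (h + h) + k) k N (ℕP.+-assoc (suc (h + h)) k k) refl)))

cong₃ : ∀ {A B C D : Set} (f : A → B → C → D) {x x′ y y′ z z′} →
  x ≡ x′ → y ≡ y′ → z ≡ z′ → f x y z ≡ f x′ y′ z′
cong₃ f refl refl refl = refl

ClosedFormAt : ℕ → ℕ → Set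
ClosedFormAt m k = P (suc m) k ≡ c (suc m) k ℚ.* closedForm m k

private
  factor-c : ∀ x₁ x₂ x₃ c T₀ r T₂ F g →
    (x₁ ℚ.* (c ℚ.* T₀) ℚ.+ x₂ ℚ.* ((c ℚ.* r) ℚ.* T₂) ℚ.+ x₃ ℚ.* (c ℚ.* F)) ℚ.* g ≡
    c ℚ.* ((x₁ ℚ.* T₀ ℚ.+ x₂ ℚ.* (r ℚ.* T₂) ℚ.+ x₃ ℚ.* F) ℚ.* g)
  factor-c = solve-∀ ℚ-ring

  odd-recurrence-cross : ∀ ν κ E S₀ S₁ S₂ C →
    + 4 ℤ.* (ν ℤ.+ κ) ℤ.* S₁ ≡ + 4 ℤ.* (ν ℤ.+ κ) ℤ.* S₀ ℤ.+ (ν ℤ.+ κ) ℤ.* S₂ ℤ.+ + 2 ℤ.* (+ 4 ℤ.* κ ℤ.+ ν) ℤ.* C →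
    ((((+ 2 ℤ.* (κ ℤ.+ ν)) ℤ.* S₀) ℤ.* (+ 1 ℤ.* (((+ 2 ℤ.* κ) ℤ.+ ν) ℤ.* (+ 2 ℤ.* E)))
        ℤ.+ (((+ 2 ℤ.* κ) ℤ.+ ν) ℤ.* ((ν ℤ.+ κ) ℤ.* S₂)) ℤ.* (+ 1 ℤ.* E)) ℤ.* (+ 1 ℤ.* E)
      ℤ.+ (((+ 4 ℤ.* κ) ℤ.+ ν) ℤ.* C) ℤ.* ((+ 1 ℤ.* E) ℤ.* (+ 1 ℤ.* (((+ 2 ℤ.* κ) ℤ.+ ν) ℤ.* (+ 2 ℤ.* E)))))
      ℤ.* + 1 ℤ.* ((+ 2 ℤ.* ((+ 2 ℤ.* κ) ℤ.+ ν)) ℤ.* E)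
    ≡ ((+ 1 ℤ.* (ν ℤ.+ κ)) ℤ.* S₁)
      ℤ.* ((((+ 1 ℤ.* E) ℤ.* (+ 1 ℤ.* (((+ 2 ℤ.* κ) ℤ.+ ν) ℤ.* (+ 2 ℤ.* E)))) ℤ.* (+ 1 ℤ.* E))
           ℤ.* (+ 4 ℤ.* (ν ℤ.+ (+ 2 ℤ.* κ))))
  odd-recurrence-cross ν κ E S₀ S₁ S₂ C h = linear-combination
    (ℤ.- (+ 2 ℤ.* E ℤ.* E ℤ.* E ℤ.* (ν ℤ.+ + 2 ℤ.* κ) ℤ.* (ν ℤ.+ + 2 ℤ.* κ))) h
    (ℤ-Solver.solve (ν ∷ κ ∷ E ∷ S₀ ∷ S₁ ∷ S₂ ∷ C ∷ []))

  even-recurrence-cross : ∀ ν κ E S₀ S₁ S₂ C →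
    + 4 ℤ.* (ν ℤ.+ κ) ℤ.* S₁ ≡ + 4 ℤ.* (ν ℤ.+ κ) ℤ.* S₀ ℤ.+ (ν ℤ.+ κ) ℤ.* S₂ ℤ.+ + 2 ℤ.* (+ 4 ℤ.* κ ℤ.+ ν) ℤ.* C →
    ((((+ 4 ℤ.* (κ ℤ.+ ν)) ℤ.* S₀) ℤ.* (+ 1 ℤ.* ((+ 1 ℤ.+ (ν ℤ.+ (+ 2 ℤ.* κ))) ℤ.* (+ 2 ℤ.* E)))
        ℤ.+ ((+ 2 ℤ.* (((+ 2 ℤ.* κ) ℤ.+ ν) ℤ.+ + 1)) ℤ.* ((ν ℤ.+ κ) ℤ.* S₂)) ℤ.* (+ 1 ℤ.* E)) ℤ.* (+ 1 ℤ.* E)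
      ℤ.+ (((+ 4 ℤ.* κ) ℤ.+ ν) ℤ.* (+ 2 ℤ.* C)) ℤ.* ((+ 1 ℤ.* E) ℤ.* (+ 1 ℤ.* ((+ 1 ℤ.+ (ν ℤ.+ (+ 2 ℤ.* κ))) ℤ.* (+ 2 ℤ.* E)))))
      ℤ.* + 1 ℤ.* (+ 1 ℤ.* E)
    ≡ ((ν ℤ.+ κ) ℤ.* S₁)
      ℤ.* ((((+ 1 ℤ.* E) ℤ.* (+ 1 ℤ.* ((+ 1 ℤ.+ (ν ℤ.+ (+ 2 ℤ.* κ))) ℤ.* (+ 2 ℤ.* E)))) ℤ.* (+ 1 ℤ.* E)) ℤ.* + 4)
  even-recurrence-cross ν κ E S₀ S₁ S₂ C h = linear-combination
    (ℤ.- (+ 2 ℤ.* E ℤ.* E ℤ.* E ℤ.* (ν ℤ.+ + 2 ℤ.* κ ℤ.+ + 1))) h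
    (ℤ-Solver.solve (ν ∷ κ ∷ E ∷ S₀ ∷ S₁ ∷ S₂ ∷ C ∷ []))

closedForm-odd-recurrence : ∀ m j → let n = suc m ; k = suc j ; r = (+ (n + k)) ℚ./ (2 * k + n) in
  (ℕtoℚ (2 * (k + n)) ℚ.* closedForm m k ℚ.+ ℕtoℚ (2 * k + n) ℚ.* (r ℚ.* closedForm m (suc k))
    ℚ.+ ℕtoℚ (4 * k + n) ℚ.* (+ binom (row m k) k /suc pred2^ k)) ℚ.* (+ 1 ℚ./ (4 * (n + 2 * k)))
  ≡ (½ ℚ.* r) ℚ.* closedForm (suc m) k
closedForm-odd-recurrence m j = trans
  (cong₃ (λ x y w → (x ℚ.* evalℚ T₀ ℚ.+ y ℚ.* (evalℚ (r :* T₂)) ℚ.+ w ℚ.* evalℚ F) ℚ.* evalℚ g)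
         (ℕtoℚ≡int (2 * (k + n)) (ℤP.pos-* 2 (k + n))) (ℕtoℚ≡int (2 * k + n) 2k+n≡)
         (ℕtoℚ≡int (4 * k + n) (cong (ℤ._+ ν) (ℤP.pos-* 4 k))))
  (by-cross-multiplication
    ((leaf (int (+ 2 ℤ.* (κ ℤ.+ ν))) :* T₀ :+ leaf (int (+ 2 ℤ.* κ ℤ.+ ν)) :* (r :* T₂)
       :+ leaf (int (+ 4 ℤ.* κ ℤ.+ ν)) :* F) :* g)
    ((leaf (frac (+ 1) 1 (+ 2) refl) :* r) :* leaf (frac (centralSum (row (suc m) k) k) (pred2^ k) E (suc-pred2^ k)))
    (odd-recurrence-cross ν κ E (centralSum (row m k) k) (centralSum (row (suc m) k) k)
       (centralSum (row m (suc k)) (suc k)) (+ binom (row m k) k) (centralSum-recurrence m j)))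
  where
  n = suc m
  k = suc j
  ν = + n
  κ = + k
  E = + (2 ^ k)
  2k+n≡ = cong (ℤ._+ ν) (ℤP.pos-* 2 k)
  T₀ = leaf (frac (centralSum (row m k) k) (pred2^ k) E (suc-pred2^ k))
  T₂ = leaf (frac (centralSum (row m (suc k)) (suc k)) (pred2^ (suc k)) (+ 2 ℤ.* E) (suc-pred2^-suc k))
  F = leaf (frac (+ binom (row m k) k) (pred2^ k) E (suc-pred2^ k))
  r = leaf (frac (ν ℤ.+ κ) (ℕ.pred (2 * k + n)) (+ 2 ℤ.* κ ℤ.+ ν) 2k+n≡)
  g = leaf (frac (+ 1) (ℕ.pred (4 * (n + 2 * k))) (+ 4 ℤ.* (ν ℤ.+ + 2 ℤ.* κ))
                 (trans (ℤP.pos-* 4 (n + 2 * k)) (cong (λ w → + 4 ℤ.* (ν ℤ.+ w)) (ℤP.pos-* 2 k))))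

closedForm-even-recurrence : ∀ m j → let n = suc m ; k = suc j ; r = (+ (n + k)) ℚ./ suc (n + 2 * k) in
  (ℕtoℚ (4 * (k + n)) ℚ.* closedForm m k ℚ.+ ℕtoℚ (2 * (2 * k + n + 1)) ℚ.* (r ℚ.* closedForm m (suc k))
    ℚ.+ ℕtoℚ (4 * k + n) ℚ.* (+ 2 ℤ.* + binom (row m k) k /suc pred2^ k)) ℚ.* (+ 1 ℚ./ 4)
  ≡ ℕtoℚ (n + k) ℚ.* closedForm (suc m) k
closedForm-even-recurrence m j = trans
  (cong₃ (λ x y w → (x ℚ.* evalℚ T₀ ℚ.+ y ℚ.* (evalℚ (r :* T₂)) ℚ.+ w ℚ.* evalℚ F) ℚ.* (+ 1 ℚ./ 4))
         (ℕtoℚ≡int (4 * (k + n)) (ℤP.pos-* 4 (k + n)))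
         (ℕtoℚ≡int (2 * (2 * k + n + 1))
           (trans (ℤP.pos-* 2 (2 * k + n + 1)) (cong (λ w → + 2 ℤ.* ((w ℤ.+ ν) ℤ.+ + 1)) (ℤP.pos-* 2 k))))
         (ℕtoℚ≡int (4 * k + n) (cong (ℤ._+ ν) (ℤP.pos-* 4 k))))
  (by-cross-multiplication
    ((leaf (int (+ 4 ℤ.* (κ ℤ.+ ν))) :* T₀ :+ leaf (int (+ 2 ℤ.* ((+ 2 ℤ.* κ ℤ.+ ν) ℤ.+ + 1))) :* (r :* T₂)
       :+ leaf (int (+ 4 ℤ.* κ ℤ.+ ν)) :* F) :* leaf (frac (+ 1) 3 (+ 4) refl))
    (leaf (int (ν ℤ.+ κ)) :* leaf (frac (centralSum (row (suc m) k) k) (pred2^ k) E (suc-pred2^ k)))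
    (even-recurrence-cross ν κ E (centralSum (row m k) k) (centralSum (row (suc m) k) k)
       (centralSum (row m (suc k)) (suc k)) (+ binom (row m k) k) (centralSum-recurrence m j)))
  where
  n = suc m
  k = suc j
  ν = + n
  κ = + k
  E = + (2 ^ k)
  T₀ = leaf (frac (centralSum (row m k) k) (pred2^ k) E (suc-pred2^ k))
  T₂ = leaf (frac (centralSum (row m (suc k)) (suc k)) (pred2^ (suc k)) (+ 2 ℤ.* E) (suc-pred2^-suc k))
  F = leaf (frac (+ 2 ℤ.* + binom (row m k) k) (pred2^ k) E (suc-pred2^ k))
  r = leaf (frac (ν ℤ.+ κ) (n + 2 * k) (+ 1 ℤ.+ (ν ℤ.+ + 2 ℤ.* κ)) (cong (λ w → + 1 ℤ.+ (ν ℤ.+ w)) (ℤP.pos-* 2 k)))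

P-step-odd : ∀ h′ j → let m = suc (h′ + suc h′) in
  ClosedFormAt m (suc j) → ClosedFormAt m (suc (suc j)) → ClosedFormAt (suc m) (suc j)
P-step-odd h′ j IH IH′ = begin
  P (suc n) k
    ≡⟨ if-cong (isOdd-odd h) ⟩
  (ℕtoℚ a₁ ℚ.* P n k ℚ.+ ℕtoℚ a₂ ℚ.* P n (suc k) ℚ.+ ℕtoℚ (a₃ * ℓ n k)) ℚ.* g
    ≡⟨ cong₂ (λ x y → (ℕtoℚ a₁ ℚ.* x ℚ.+ ℕtoℚ a₂ ℚ.* y ℚ.+ ℕtoℚ (a₃ * ℓ n k)) ℚ.* g) IH IH′ ⟩
  (ℕtoℚ a₁ ℚ.* (c₀ ℚ.* T₀) ℚ.+ ℕtoℚ a₂ ℚ.* (c n (suc k) ℚ.* T₂) ℚ.+ ℕtoℚ (a₃ * ℓ n k)) ℚ.* g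
    ≡⟨ cong₂ (λ y w → (ℕtoℚ a₁ ℚ.* (c₀ ℚ.* T₀) ℚ.+ ℕtoℚ a₂ ℚ.* (y ℚ.* T₂) ℚ.+ w) ℚ.* g) (c-odd-suc h j) ℓ≡ ⟩
  (ℕtoℚ a₁ ℚ.* (c₀ ℚ.* T₀) ℚ.+ ℕtoℚ a₂ ℚ.* ((c₀ ℚ.* r) ℚ.* T₂) ℚ.+ ℕtoℚ a₃ ℚ.* (c₀ ℚ.* F)) ℚ.* g
    ≡⟨ factor-c (ℕtoℚ a₁) (ℕtoℚ a₂) (ℕtoℚ a₃) c₀ T₀ r T₂ F g ⟩
  c₀ ℚ.* ((ℕtoℚ a₁ ℚ.* T₀ ℚ.+ ℕtoℚ a₂ ℚ.* (r ℚ.* T₂) ℚ.+ ℕtoℚ a₃ ℚ.* F) ℚ.* g)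
    ≡⟨ cong (c₀ ℚ.*_) (closedForm-odd-recurrence m j) ⟩
  c₀ ℚ.* ((½ ℚ.* r) ℚ.* T₁)
    ≡⟨ ℚP.*-assoc c₀ (½ ℚ.* r) T₁ ⟨
  (c₀ ℚ.* (½ ℚ.* r)) ℚ.* T₁
    ≡⟨ cong (ℚ._* T₁) (c-odd→even h j) ⟨
  c (suc n) k ℚ.* T₁ ∎
  where
  h = suc h′
  m = suc (h′ + suc h′)
  n = suc m
  k = suc j
  a₁ = 2 * (k + n)
  a₂ = 2 * k + n
  a₃ = 4 * k + n
  g = + 1 ℚ./ (4 * (n + 2 * k))
  c₀ = c n k
  T₀ = closedForm m k
  T₁ = closedForm (suc m) k
  T₂ = closedForm m (suc k)
  F = + binom (row m k) k /suc pred2^ k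
  r = (+ (n + k)) ℚ./ (2 * k + n)
  ℓ≡ : ℕtoℚ (a₃ * ℓ n k) ≡ ℕtoℚ a₃ ℚ.* (c₀ ℚ.* F)
  ℓ≡ = trans (ℕtoℚ-* a₃ (ℓ n k)) (cong (ℕtoℚ a₃ ℚ.*_) (trans (cong (λ t → ℕtoℚ (lprod t k)) (⌊odd/2⌋ h)) (ℓ-odd h j)))

P-step-even : ∀ h j → let m = suc (h + h) in
  ClosedFormAt m (suc j) → ClosedFormAt m (suc (suc j)) → ClosedFormAt (suc m) (suc j)
P-step-even h j IH IH′ = begin
  P (suc n) k
    ≡⟨ if-cong (trans (isOdd-suc-suc (h + h)) (isOdd-even h)) ⟩
  (ℕtoℚ a₁ ℚ.* P n k ℚ.+ ℕtoℚ a₂ ℚ.* P n (suc k) ℚ.+ ℕtoℚ (a₃ * ℓ m k)) ℚ.* g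
    ≡⟨ cong₂ (λ x y → (ℕtoℚ a₁ ℚ.* x ℚ.+ ℕtoℚ a₂ ℚ.* y ℚ.+ ℕtoℚ (a₃ * ℓ m k)) ℚ.* g) IH IH′ ⟩
  (ℕtoℚ a₁ ℚ.* (c₀ ℚ.* T₀) ℚ.+ ℕtoℚ a₂ ℚ.* (c n (suc k) ℚ.* T₂) ℚ.+ ℕtoℚ (a₃ * ℓ m k)) ℚ.* g
    ≡⟨ cong₂ (λ y w → (ℕtoℚ a₁ ℚ.* (c₀ ℚ.* T₀) ℚ.+ ℕtoℚ a₂ ℚ.* (y ℚ.* T₂) ℚ.+ w) ℚ.* g) (c-even-suc h k) ℓ≡ ⟩
  (ℕtoℚ a₁ ℚ.* (c₀ ℚ.* T₀) ℚ.+ ℕtoℚ a₂ ℚ.* ((c₀ ℚ.* r) ℚ.* T₂) ℚ.+ ℕtoℚ a₃ ℚ.* (c₀ ℚ.* F)) ℚ.* g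
    ≡⟨ factor-c (ℕtoℚ a₁) (ℕtoℚ a₂) (ℕtoℚ a₃) c₀ T₀ r T₂ F g ⟩
  c₀ ℚ.* ((ℕtoℚ a₁ ℚ.* T₀ ℚ.+ ℕtoℚ a₂ ℚ.* (r ℚ.* T₂) ℚ.+ ℕtoℚ a₃ ℚ.* F) ℚ.* g)
    ≡⟨ cong (c₀ ℚ.*_) (closedForm-even-recurrence m j) ⟩
  c₀ ℚ.* (ℕtoℚ (n + k) ℚ.* T₁)
    ≡⟨ ℚP.*-assoc c₀ (ℕtoℚ (n + k)) T₁ ⟨
  (c₀ ℚ.* ℕtoℚ (n + k)) ℚ.* T₁
    ≡⟨ cong (ℚ._* T₁) (c-even→odd h j) ⟨
  c (suc n) k ℚ.* T₁ ∎
  where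
  m = suc (h + h)
  n = suc m
  k = suc j
  a₁ = 4 * (k + n)
  a₂ = 2 * (2 * k + n + 1)
  a₃ = 4 * k + n
  g = + 1 ℚ./ 4
  c₀ = c n k
  T₀ = closedForm m k
  T₁ = closedForm (suc m) k
  T₂ = closedForm m (suc k)
  F = + 2 ℤ.* + binom (row m k) k /suc pred2^ k
  r = (+ (n + k)) ℚ./ suc (n + 2 * k)
  ℓ≡ : ℕtoℚ (a₃ * ℓ m k) ≡ ℕtoℚ a₃ ℚ.* (c₀ ℚ.* F)
  ℓ≡ = trans (ℕtoℚ-* a₃ (ℓ m k)) (cong (ℕtoℚ a₃ ℚ.*_) (trans (cong (λ t → ℕtoℚ (lprod t k)) (⌊odd/2⌋ h)) (ℓ-even h k)))

binom-central-suc : ∀ k → suc k * binom (suc k + suc k) (suc k) ≡ 2 * (2 * k + 1) * binom (k + k) k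
binom-central-suc k = subst (λ w → suc k * binom w (suc k) ≡ 2 * (2 * k + 1) * binom (k + k) k)
  (sym (cong suc (ℕP.+-suc k k))) (begin
  suc k * binom (suc (suc M)) (suc k) ≡⟨ binom-absorption (suc M) k ⟩
  suc (suc M) * binom (suc M) k       ≡⟨ double k (binom (suc M) k) ⟩
  2 * (suc k * binom (suc M) k)       ≡⟨ cong (2 *_) (binom-ratio (suc k) k) ⟨
  2 * (suc k * binom (suc M) (suc k)) ≡⟨ cong (2 *_) (binom-absorption M k) ⟩
  2 * (suc M * binom M k)             ≡⟨ regroup k (binom M k) ⟩
  2 * (2 * k + 1) * binom M k         ∎)
  where
  M = k + k
  double : ∀ k X → suc (suc (k + k)) * X ≡ 2 * (suc k * X)
  double = ℕ-Solver.solve-∀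
  regroup : ∀ k Y → 2 * (suc (k + k) * Y) ≡ 2 * (2 * k + 1) * Y
  regroup = ℕ-Solver.solve-∀

binom-central-suc-odd : ∀ k →
  (2 + k) * binom (suc (suc k + suc k)) (suc k) ≡ (2 * k + 3) * (2 * binom (suc (k + k)) k)
binom-central-suc-odd k = subst (λ w → (2 + k) * binom w (suc k) ≡ (2 * k + 3) * (2 * binom (suc (k + k)) k))
  (sym (cong (λ x → suc (suc x)) (ℕP.+-suc k k))) (begin
  suc (suc k) * binom (suc (suc M)) (suc k)        ≡⟨ symmetric ⟨
  suc (suc k) * binom (suc (suc M)) (suc (suc k))  ≡⟨ binom-absorption (suc M) (suc k) ⟩
  suc (suc M) * binom (suc M) (suc k)              ≡⟨ cong (suc (suc M) *_) middle ⟩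
  suc (suc M) * (2 * binom M k)                    ≡⟨ cong (_* (2 * binom M k)) (three k) ⟩
  (2 * k + 3) * (2 * binom M k)                    ∎)
  where
  M = suc (k + k)
  symmetric : suc (suc k) * binom (suc (suc M)) (suc (suc k)) ≡ suc (suc k) * binom (suc (suc M)) (suc k)
  symmetric = subst (λ w → suc (suc k) * binom w (suc (suc k)) ≡ suc (suc k) * binom w (suc k))
    (cong (λ x → suc (suc x)) (ℕP.+-suc k k)) (binom-ratio (suc (suc k)) (suc k))
  three : ∀ k → suc (suc (suc (k + k))) ≡ 2 * k + 3
  three = ℕ-Solver.solve-∀
  middle : binom (suc M) (suc k) ≡ 2 * binom M k
  middle = ℕP.*-cancelˡ-≡ _ _ (suc k) (trans (binom-absorption M k) (double k (binom M k)))
    where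
    double : ∀ k X → suc (suc (k + k)) * X ≡ suc k * (2 * X)
    double = ℕ-Solver.solve-∀

oddProd-1-inverse : ∀ j → oddProd 1 j ℚ.* (+ binom (suc j + suc j) (suc j) /suc pred2^ (suc j)) ≡ ℚ.1ℚ
oddProd-1-inverse zero = refl
oddProd-1-inverse (suc j) = begin
  (oddProd 1 j ℚ.* o) ℚ.* X′ ≡⟨ ℚP.*-assoc (oddProd 1 j) o X′ ⟩
  oddProd 1 j ℚ.* (o ℚ.* X′) ≡⟨ cong (oddProd 1 j ℚ.*_) shift ⟩
  oddProd 1 j ℚ.* X          ≡⟨ oddProd-1-inverse j ⟩
  ℚ.1ℚ                       ∎
  where
  k = suc j
  o = (+ (1 + suc j)) ℚ./ (2 * suc j + 1)
  C′ = + binom (suc k + suc k) (suc k)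
  C = + binom (k + k) k
  X′ = C′ /suc pred2^ (suc k)
  X = C /suc pred2^ k
  κ = + k
  E = + (2 ^ k)
  ratio : (+ 1 ℤ.+ κ) ℤ.* C′ ≡ (+ 2 ℤ.* ((+ 2 ℤ.* κ) ℤ.+ + 1)) ℤ.* C
  ratio = trans (sym (ℤP.pos-* (suc k) (binom (suc k + suc k) (suc k))))
    (trans (cong +_ (binom-central-suc k)) (trans (ℤP.pos-* (2 * (2 * k + 1)) (binom (k + k) k))
      (cong (ℤ._* C) (trans (ℤP.pos-* 2 (2 * k + 1)) (cong (λ w → + 2 ℤ.* (w ℤ.+ + 1)) (ℤP.pos-* 2 k))))))
  identity : ∀ κ E C C′ → (+ 1 ℤ.+ κ) ℤ.* C′ ≡ (+ 2 ℤ.* ((+ 2 ℤ.* κ) ℤ.+ + 1)) ℤ.* C →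
    ((+ 1 ℤ.+ κ) ℤ.* C′) ℤ.* E ≡ C ℤ.* (((+ 2 ℤ.* κ) ℤ.+ + 1) ℤ.* (+ 2 ℤ.* E))
  identity κ E C C′ h = linear-combination E h (ℤ-Solver.solve (κ ∷ E ∷ C ∷ C′ ∷ []))
  shift : o ℚ.* X′ ≡ X
  shift = by-cross-multiplication
    (leaf (frac (+ 1 ℤ.+ κ) (ℕ.pred (2 * k + 1)) ((+ 2 ℤ.* κ) ℤ.+ + 1) (cong (ℤ._+ + 1) (ℤP.pos-* 2 k)))
     :* leaf (frac C′ (pred2^ (suc k)) (+ 2 ℤ.* E) (suc-pred2^-suc k)))
    (leaf (frac C (pred2^ k) E (suc-pred2^ k))) (identity κ E C C′ ratio)

evenProd-2-inverse : ∀ k → evenProd 2 k ℚ.* (+ binom (suc (k + k)) k /suc pred2^ k) ≡ ℚ.1ℚ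
evenProd-2-inverse zero = refl
evenProd-2-inverse (suc k) = begin
  (evenProd 2 k ℚ.* e) ℚ.* X′ ≡⟨ ℚP.*-assoc (evenProd 2 k) e X′ ⟩
  evenProd 2 k ℚ.* (e ℚ.* X′) ≡⟨ cong (evenProd 2 k ℚ.*_) shift ⟩
  evenProd 2 k ℚ.* X          ≡⟨ evenProd-2-inverse k ⟩
  ℚ.1ℚ                        ∎
  where
  e = (+ (2 + k)) ℚ./ suc (2 + 2 * k)
  C′ = + binom (suc (suc k + suc k)) (suc k)
  C = + binom (suc (k + k)) k
  X′ = C′ /suc pred2^ (suc k)
  X = C /suc pred2^ k
  κ = + k
  E = + (2 ^ k)
  ratio : (+ 2 ℤ.+ κ) ℤ.* C′ ≡ ((+ 2 ℤ.* κ) ℤ.+ + 3) ℤ.* (+ 2 ℤ.* C)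
  ratio = trans (sym (ℤP.pos-* (2 + k) (binom (suc (suc k + suc k)) (suc k))))
    (trans (cong +_ (binom-central-suc-odd k)) (trans (ℤP.pos-* (2 * k + 3) (2 * binom (suc (k + k)) k))
      (cong₂ ℤ._*_ (cong (ℤ._+ + 3) (ℤP.pos-* 2 k)) (ℤP.pos-* 2 (binom (suc (k + k)) k)))))
  identity : ∀ κ E C C′ → (+ 2 ℤ.+ κ) ℤ.* C′ ≡ ((+ 2 ℤ.* κ) ℤ.+ + 3) ℤ.* (+ 2 ℤ.* C) →
    ((+ 2 ℤ.+ κ) ℤ.* C′) ℤ.* E ≡ C ℤ.* ((+ 1 ℤ.+ (+ 2 ℤ.+ (+ 2 ℤ.* κ))) ℤ.* (+ 2 ℤ.* E))
  identity κ E C C′ h = linear-combination E h (ℤ-Solver.solve (κ ∷ E ∷ C ∷ C′ ∷ []))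
  shift : e ℚ.* X′ ≡ X
  shift = by-cross-multiplication
    (leaf (frac (+ 2 ℤ.+ κ) (2 + 2 * k) (+ 1 ℤ.+ (+ 2 ℤ.+ (+ 2 ℤ.* κ))) (cong (λ w → + 1 ℤ.+ (+ 2 ℤ.+ w)) (ℤP.pos-* 2 k)))
     :* leaf (frac C′ (pred2^ (suc k)) (+ 2 ℤ.* E) (suc-pred2^-suc k)))
    (leaf (frac C (pred2^ k) E (suc-pred2^ k))) (identity κ E C C′ ratio)

P-1 : ∀ j → ClosedFormAt 0 (suc j)
P-1 j = sym (begin
  c 1 k ℚ.* closedForm 0 k
    ≡⟨ cong₂ ℚ._*_ (c-odd 0 k) (cong (_/suc pred2^ k) (centralSum-centre j)) ⟩
  (ℕtoℚ 1 ℚ.* oddProd 1 j) ℚ.* (+ binom (k + k) k /suc pred2^ k)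
    ≡⟨ ℚP.*-assoc (ℕtoℚ 1) (oddProd 1 j) _ ⟩
  ℕtoℚ 1 ℚ.* (oddProd 1 j ℚ.* (+ binom (k + k) k /suc pred2^ k))
    ≡⟨ cong (ℕtoℚ 1 ℚ.*_) (oddProd-1-inverse j) ⟩
  ℕtoℚ 1 ℚ.* ℚ.1ℚ ≡⟨⟩
  ℕtoℚ 1 ∎)
  where k = suc j

P-2 : ∀ j → ClosedFormAt 1 (suc j)
P-2 j = sym (begin
  c 2 k ℚ.* closedForm 1 k
    ≡⟨ cong₂ ℚ._*_ (c-even 0 k) (cong (_/suc pred2^ k) (centralSum-centre-odd j)) ⟩
  ((½ ℚ.* ℕtoℚ 1) ℚ.* evenProd 2 k) ℚ.* (+ 2 ℤ.* C /suc pred2^ k)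
    ≡⟨ cong (((½ ℚ.* ℕtoℚ 1) ℚ.* evenProd 2 k) ℚ.*_) double ⟩
  ((½ ℚ.* ℕtoℚ 1) ℚ.* evenProd 2 k) ℚ.* (ℕtoℚ 2 ℚ.* X)
    ≡⟨ swap ½ (ℕtoℚ 1) (evenProd 2 k) (ℕtoℚ 2) X ⟩
  ((½ ℚ.* ℕtoℚ 2) ℚ.* ℕtoℚ 1) ℚ.* (evenProd 2 k ℚ.* X)
    ≡⟨ cong (((½ ℚ.* ℕtoℚ 2) ℚ.* ℕtoℚ 1) ℚ.*_) (evenProd-2-inverse k) ⟩
  ((½ ℚ.* ℕtoℚ 2) ℚ.* ℕtoℚ 1) ℚ.* ℚ.1ℚ ≡⟨⟩
  ℕtoℚ 1 ∎)
  where
  k = suc j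
  C = + binom (suc (k + k)) k
  X = C /suc pred2^ k
  E = + (2 ^ k)
  identity : ∀ E C → (+ 2 ℤ.* C) ℤ.* (+ 1 ℤ.* E) ≡ (+ 2 ℤ.* C) ℤ.* E
  identity = ℤ-Solver.solve-∀
  double : (+ 2 ℤ.* C /suc pred2^ k) ≡ ℕtoℚ 2 ℚ.* X
  double = by-cross-multiplication (leaf (frac (+ 2 ℤ.* C) (pred2^ k) E (suc-pred2^ k)))
    (leaf (int (+ 2)) :* leaf (frac C (pred2^ k) E (suc-pred2^ k))) (identity E C)
  swap : ∀ a b e t X → ((a ℚ.* b) ℚ.* e) ℚ.* (t ℚ.* X) ≡ ((a ℚ.* t) ℚ.* b) ℚ.* (e ℚ.* X)
  swap = solve-∀ ℚ-ring

P-step : ∀ z j → ClosedFormAt (suc z) (suc j) → ClosedFormAt (suc z) (suc (suc j)) → ClosedFormAt (suc (suc z)) (suc j)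
P-step z j with parity z
... | even h = P-step-even h j
... | odd h = P-step-odd h j

P-closed-form : ∀ m j → ClosedFormAt m (suc j)
P-closed-form zero j = P-1 j
P-closed-form (suc zero) j = P-2 j
P-closed-form (suc (suc z)) j = P-step z j (P-closed-form (suc z) j) (P-closed-form (suc z) (suc j))

addPoly : List ℤ → List ℤ → List ℤ
addPoly [] q = q
addPoly (a ∷ p) [] = a ∷ p
addPoly (a ∷ p) (b ∷ q) = (a ℤ.+ b) ∷ addPoly p q

scalePoly : ℤ → List ℤ → List ℤ
scalePoly s = map (s ℤ.*_)

mulLinear : ℤ → List ℤ → List ℤ
mulLinear a p = addPoly (scalePoly a p) (+ 0 ∷ p)

evalPoly-add : ∀ p q x → evalPoly (addPoly p q) x ≡ evalPoly p x ℤ.+ evalPoly q x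
evalPoly-add [] q x = sym (ℤP.+-identityˡ (evalPoly q x))
evalPoly-add (a ∷ p) [] x = sym (ℤP.+-identityʳ _)
evalPoly-add (a ∷ p) (b ∷ q) x =
  trans (cong (λ z → (a ℤ.+ b) ℤ.+ x ℤ.* z) (evalPoly-add p q x)) (regroup a b x (evalPoly p x) (evalPoly q x))
  where
  regroup : ∀ a b x u v → (a ℤ.+ b) ℤ.+ x ℤ.* (u ℤ.+ v) ≡ (a ℤ.+ x ℤ.* u) ℤ.+ (b ℤ.+ x ℤ.* v)
  regroup = ℤ-Solver.solve-∀

evalPoly-scale : ∀ s p x → evalPoly (scalePoly s p) x ≡ s ℤ.* evalPoly p x
evalPoly-scale s [] x = sym (ℤP.*-zeroʳ s)
evalPoly-scale s (a ∷ p) x = trans (cong (λ z → s ℤ.* a ℤ.+ x ℤ.* z) (evalPoly-scale s p x)) (regroup s a x (evalPoly p x))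
  where
  regroup : ∀ s a x u → s ℤ.* a ℤ.+ x ℤ.* (s ℤ.* u) ≡ s ℤ.* (a ℤ.+ x ℤ.* u)
  regroup = ℤ-Solver.solve-∀

evalPoly-mulLinear : ∀ a p x → evalPoly (mulLinear a p) x ≡ (x ℤ.+ a) ℤ.* evalPoly p x
evalPoly-mulLinear a p x = trans (evalPoly-add (scalePoly a p) (+ 0 ∷ p) x)
  (trans (cong (ℤ._+ (+ 0 ℤ.+ x ℤ.* evalPoly p x)) (evalPoly-scale a p x)) (regroup a x (evalPoly p x)))
  where
  regroup : ∀ a x u → a ℤ.* u ℤ.+ (+ 0 ℤ.+ x ℤ.* u) ≡ (x ℤ.+ a) ℤ.* u
  regroup = ℤ-Solver.solve-∀

length-addPoly : ∀ p q → length p < length q → length (addPoly p q) ≡ length q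
length-addPoly [] q _ = refl
length-addPoly (a ∷ p) (b ∷ q) (s≤s lt) = cong suc (length-addPoly p q lt)

last-addPoly : ∀ p q → length p < length q → last (addPoly p q) ≡ last q
last-addPoly [] q _ = refl
last-addPoly (a ∷ []) (b ∷ b′ ∷ q) (s≤s _) = refl
last-addPoly (a ∷ a′ ∷ p) (b ∷ b′ ∷ q) (s≤s lt) = last-addPoly (a′ ∷ p) (b′ ∷ q) lt

length-scalePoly : ∀ s p → length (scalePoly s p) ≡ length p
length-scalePoly s = ListP.length-map (s ℤ.*_)

private
  scalePoly-shorter : ∀ s p → length (scalePoly s p) < length (+ 0 ∷ p)
  scalePoly-shorter s p = subst (_< suc (length p)) (sym (length-scalePoly s p)) (ℕP.n<1+n (length p))

length-mulLinear : ∀ a p → length (mulLinear a p) ≡ suc (length p)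
length-mulLinear a p = length-addPoly (scalePoly a p) (+ 0 ∷ p) (scalePoly-shorter a p)

last-mulLinear : ∀ a b p → last (mulLinear a (b ∷ p)) ≡ last (b ∷ p)
last-mulLinear a b p = last-addPoly (scalePoly a (b ∷ p)) (+ 0 ∷ b ∷ p) (scalePoly-shorter a (b ∷ p))

-- fallingPoly s i = (x + s)(x + s − 1)⋯(x + s − i + 1); meaningful for i ≤ s only, as s ∸ i truncates.
fallingPoly : ℕ → ℕ → List ℤ
fallingPoly s zero = + 1 ∷ []
fallingPoly s (suc i) = mulLinear (+ (s ∸ i)) (fallingPoly s i)

-- sumPoly s i = Σ_{t ≤ i} (i! / t!) · fallingPoly s t, which is i! Σ_{t ≤ i} C(x + s, t)
sumPoly : ℕ → ℕ → List ℤ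
sumPoly s zero = + 1 ∷ []
sumPoly s (suc i) = addPoly (scalePoly (+ suc i) (sumPoly s i)) (fallingPoly s (suc i))

length-fallingPoly : ∀ s i → length (fallingPoly s i) ≡ suc i
length-fallingPoly s zero = refl
length-fallingPoly s (suc i) = trans (length-mulLinear (+ (s ∸ i)) (fallingPoly s i)) (cong suc (length-fallingPoly s i))

last-fallingPoly : ∀ s i → last (fallingPoly s i) ≡ just (+ 1)
last-fallingPoly s zero = refl
last-fallingPoly s (suc i) with fallingPoly s i | last-fallingPoly s i
... | b ∷ p | last≡ = trans (last-mulLinear (+ (s ∸ i)) b p) last≡

length-sumPoly : ∀ s i → length (sumPoly s i) ≡ suc i
last-sumPoly : ∀ s i → last (sumPoly s i) ≡ just (+ 1)

private
  sumPoly-summands : ∀ s i → length (scalePoly (+ suc i) (sumPoly s i)) < length (fallingPoly s (suc i))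
  sumPoly-summands s i = subst₂ _<_ (sym (trans (length-scalePoly (+ suc i) (sumPoly s i)) (length-sumPoly s i)))
    (sym (length-fallingPoly s (suc i))) (ℕP.n<1+n (suc i))

length-sumPoly s zero = refl
length-sumPoly s (suc i) = trans (length-addPoly (scalePoly (+ suc i) (sumPoly s i)) (fallingPoly s (suc i)) (sumPoly-summands s i)) (length-fallingPoly s (suc i))

last-sumPoly s zero = refl
last-sumPoly s (suc i) = trans (last-addPoly (scalePoly (+ suc i) (sumPoly s i)) (fallingPoly s (suc i)) (sumPoly-summands s i)) (last-fallingPoly s (suc i))

evalPoly-fallingPoly : ∀ s n i → i ≤ s → evalPoly (fallingPoly s i) (+ n) ≡ + (i ! * binom (n + s) i)
evalPoly-fallingPoly s n zero _ = cong (λ z → + 1 ℤ.+ z) (ℤP.*-zeroʳ (+ n))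
evalPoly-fallingPoly s n (suc i) i<s = begin
  evalPoly (mulLinear (+ (s ∸ i)) (fallingPoly s i)) (+ n)
    ≡⟨ evalPoly-mulLinear (+ (s ∸ i)) (fallingPoly s i) (+ n) ⟩
  (+ n ℤ.+ + (s ∸ i)) ℤ.* evalPoly (fallingPoly s i) (+ n)
    ≡⟨ cong ((+ n ℤ.+ + (s ∸ i)) ℤ.*_) (evalPoly-fallingPoly s n i (ℕP.<⇒≤ i<s)) ⟩
  + (n + (s ∸ i)) ℤ.* + (i ! * binom X i)
    ≡⟨ ℤP.pos-* (n + (s ∸ i)) (i ! * binom X i) ⟨
  + ((n + (s ∸ i)) * (i ! * binom X i))
    ≡⟨ cong +_ step ⟩
  + (suc i ! * binom X (suc i)) ∎
  where
  X = n + s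
  a = n + (s ∸ i)
  a+i≡X : a + i ≡ X
  a+i≡X = trans (ℕP.+-assoc n (s ∸ i) i) (cong (λ z → n + z) (ℕP.m∸n+n≡m (ℕP.<⇒≤ i<s)))
  ratio : suc i * binom X (suc i) ≡ a * binom X i
  ratio = subst (λ w → suc i * binom w (suc i) ≡ a * binom w i) a+i≡X (binom-ratio a i)
  swap₁ : ∀ a f b → a * (f * b) ≡ f * (a * b)
  swap₁ = ℕ-Solver.solve-∀
  swap₂ : ∀ f s b → f * (s * b) ≡ (s * f) * b
  swap₂ = ℕ-Solver.solve-∀
  step : a * (i ! * binom X i) ≡ suc i ! * binom X (suc i)
  step = trans (swap₁ a (i !) (binom X i)) (trans (cong (i ! *_) (sym ratio)) (swap₂ (i !) (suc i) (binom X (suc i))))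

evalPoly-sumPoly : ∀ s n i → i ≤ s → evalPoly (sumPoly s i) (+ n) ≡ + (i ! * binomSum (n + s) (suc i))
evalPoly-sumPoly s n zero _ = cong (λ z → + 1 ℤ.+ z) (ℤP.*-zeroʳ (+ n))
evalPoly-sumPoly s n (suc i) i<s = begin
  evalPoly (addPoly (scalePoly (+ suc i) (sumPoly s i)) (fallingPoly s (suc i))) (+ n)
    ≡⟨ evalPoly-add (scalePoly (+ suc i) (sumPoly s i)) (fallingPoly s (suc i)) (+ n) ⟩
  evalPoly (scalePoly (+ suc i) (sumPoly s i)) (+ n) ℤ.+ evalPoly (fallingPoly s (suc i)) (+ n)
    ≡⟨ cong₂ ℤ._+_ (evalPoly-scale (+ suc i) (sumPoly s i) (+ n)) (evalPoly-fallingPoly s n (suc i) i<s) ⟩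
  + suc i ℤ.* evalPoly (sumPoly s i) (+ n) ℤ.+ + (suc i ! * binom X (suc i))
    ≡⟨ cong (λ z → + suc i ℤ.* z ℤ.+ + (suc i ! * binom X (suc i))) (evalPoly-sumPoly s n i (ℕP.<⇒≤ i<s)) ⟩
  + suc i ℤ.* + (i ! * binomSum X (suc i)) ℤ.+ + (suc i ! * binom X (suc i))
    ≡⟨ cong (ℤ._+ + (suc i ! * binom X (suc i))) (ℤP.pos-* (suc i) (i ! * binomSum X (suc i))) ⟨
  + (suc i * (i ! * binomSum X (suc i)) + suc i ! * binom X (suc i))
    ≡⟨ cong +_ (factor (suc i) (i !) (binomSum X (suc i)) (binom X (suc i))) ⟩
  + ((suc i * i !) * (binomSum X (suc i) + binom X (suc i))) ∎
  where
  X = n + s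
  factor : ∀ s f b c → s * (f * b) + (s * f) * c ≡ (s * f) * (b + c)
  factor = ℕ-Solver.solve-∀

-- R j is the paper's R_{j+1}, where R_k(n) = (k − 1)! Σ_{i<k} C(n − 1 + 2k, i).
R : ℕ → List ℤ
R j = sumPoly (suc (j + j)) j

R-degree : ∀ j → HasDegree (R j) j
R-degree j = length-sumPoly (suc (j + j)) j ,
  λ a last≡ a≡0 → 1≢0 (trans (MaybeP.just-injective (trans (sym (last-sumPoly (suc (j + j)) j)) last≡)) a≡0)
  where
  1≢0 : + 1 ≢ + 0
  1≢0 ()

evalPoly-R : ∀ j m → evalPoly (R j) (+ suc m) ≡ + (j ! * binomSum (row m (suc j)) (suc j))
evalPoly-R j m = trans (evalPoly-sumPoly (suc (j + j)) (suc m) j (ℕP.≤-trans (ℕP.m≤n+m j j) (ℕP.n≤1+n (j + j))))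
  (cong (λ w → + (j ! * binomSum w (suc j))) (shift m j))
  where
  shift : ∀ m j → suc m + suc (j + j) ≡ m + (suc j + suc j)
  shift = ℕ-Solver.solve-∀

closedForm-divDF : ∀ m j →
  ℕtoℚ (2 ^ (m + suc j)) ℚ.- divDF (+ (j ! * binomSum (row m (suc j)) (suc j))) (suc j) ≡ closedForm m (suc j)
closedForm-divDF m j = begin
  ℕtoℚ (2 ^ (m + k)) ℚ.- divDF (+ (j ! * B)) k
    ≡⟨ cong (λ w → ℕtoℚ (2 ^ (m + k)) ℚ.- w) (/-suc-pred (+ (j ! * B)) D) ⟩
  ℕtoℚ (2 ^ (m + k)) ℚ.- (+ (j ! * B) /suc ℕ.pred D)
    ≡⟨ cong (λ w → ℕtoℚ (2 ^ (m + k)) ℚ.- (w /suc ℕ.pred D)) (ℤP.pos-* (j !) B) ⟩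
  evalℚ lhs
    ≡⟨ by-cross-multiplication lhs rhs (identity A 2ʲ (+ (j !)) (+ B)) ⟩
  evalℚ rhs
    ≡⟨ cong (_/suc pred2^ k) centralSum≡ ⟨
  closedForm m k ∎
  where
  k = suc j
  N = row m k
  B = binomSum N k
  D = 2 ^ j * j !
  instance
    D≢0 : ℕ.NonZero D
    D≢0 = ℕP.m*n≢0 (2 ^ j) (j !) {{ℕP.m^n≢0 2 j}} {{j ℕP.!≢0}}
  /-suc-pred : ∀ z d .{{_ : ℕ.NonZero d}} → z ℚ./ d ≡ z /suc ℕ.pred d
  /-suc-pred z (suc d) = refl
  A = + (2 ^ (m + k))
  2ʲ = + (2 ^ j)
  lhs = leaf (int A) :+ neg (leaf (frac (+ (j !) ℤ.* + B) (ℕ.pred D) (2ʲ ℤ.* + (j !))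
                                       (trans (cong +_ (ℕP.suc-pred D)) (ℤP.pos-* (2 ^ j) (j !)))))
  rhs = leaf (frac (A ℤ.* (+ 2 ℤ.* 2ʲ) ℤ.- + 2 ℤ.* + B) (pred2^ k) (+ 2 ℤ.* 2ʲ) (suc-pred2^-suc j))
  identity : ∀ A P F B → (A ℤ.* (P ℤ.* F) ℤ.+ (ℤ.- (F ℤ.* B)) ℤ.* + 1) ℤ.* (+ 2 ℤ.* P) ≡
                         (A ℤ.* (+ 2 ℤ.* P) ℤ.- + 2 ℤ.* B) ℤ.* (+ 1 ℤ.* (P ℤ.* F))
  identity = ℤ-Solver.solve-∀
  2^N≡ : 2 ^ N ≡ 2 ^ (m + k) * 2 ^ k
  2^N≡ = trans (cong (2 ^_) (sym (ℕP.+-assoc m k k))) (ℕP.^-distribˡ-+-* 2 (m + k) k)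
  centralSum≡ : centralSum N k ≡ A ℤ.* (+ 2 ℤ.* 2ʲ) ℤ.- + 2 ℤ.* + B
  centralSum≡ = cong (ℤ._- + 2 ℤ.* + B)
    (trans (cong +_ 2^N≡) (trans (ℤP.pos-* (2 ^ (m + k)) (2 ^ k)) (cong (A ℤ.*_) (ℤP.pos-* 2 (2 ^ j)))))

theorem3 : (k : ℕ) → 1 ≤ k →
    Σ (List ℤ) (λ R → HasDegree R (k ∸ 1) ×
    ((n : ℕ) → 1 ≤ n →
    P n k ≡ c n k ℚ.* (ℕtoℚ (2 ^ (n + k ∸ 1)) ℚ.- divDF (evalPoly R (+ n)) k)))
theorem3 (suc j) (s≤s z≤n) = R j , R-degree j , λ where
  (suc m) (s≤s z≤n) → begin
    P (suc m) (suc j)                          ≡⟨ P-closed-form m j ⟩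
    c (suc m) (suc j) ℚ.* closedForm m (suc j) ≡⟨ cong (c (suc m) (suc j) ℚ.*_) (closedForm-divDF m j) ⟨
    c (suc m) (suc j) ℚ.* (ℕtoℚ (2 ^ (m + suc j)) ℚ.- divDF (+ (j ! * binomSum (row m (suc j)) (suc j))) (suc j))
      ≡⟨ cong (λ z → c (suc m) (suc j) ℚ.* (ℕtoℚ (2 ^ (m + suc j)) ℚ.- divDF z (suc j))) (evalPoly-R j m) ⟨
    c (suc m) (suc j) ℚ.* (ℕtoℚ (2 ^ (m + suc j)) ℚ.- divDF (evalPoly (R j) (+ suc m)) (suc j)) ∎
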